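{- For $n \geq 6$, consider partitions of $n$ with parts $q_1 \geq q_2 \geq \cdots \geq q_h$ such that $h \geq 4$, $q_j - q_{j+1} \in \{0,1\}$ for all $1 \leq j \leq h-1$, $q_1 = q_2$, and $q_{h-2} = 3$, $q_{h-1} = 2$, $q_h = 1$. Let $e'(n)$ (respectively $o'(n)$) be the number of such partitions of $n$ with an even (respectively odd) number $h$ of parts. Then for every $n \geq 6$: (a) $e'(n) = o'(n)$ whenever $n$ is not of any of the forms $\tfrac12(3t^2+t+4)$, $\tfrac12(3(t+1)^2-t-1)$, $\tfrac12(3(t+1)^2-t+3)$, $\tfrac12(3(t+1)^2+t+1)$ with $t$ an integer $\geq 2$; (b) $e'(n) = o'(n) + 1$ whenever $n = \tfrac12(3t^2+t+4)$ or $n = \tfrac12(3(t+1)^2+t+1)$ for some integer $t \geq 2$; (c) $e'(n) = o'(n) - 1$ whenever $n = \tfrac12(3(t+1)^2-t-1)$ or $n = \tfrac12(3(t+1)^2-t+3)$ for some integer $t \geq 2$. -}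

module Defs where

open import Data.Nat using (ℕ; zero; suc; _+_; _*_; _∸_; _^_; _≤_; _<_; _%_)
open import Data.List using (List; []; _∷_; _++_; length)
open import Data.Nat.ListAction using (sum)
open import Data.List.Relation.Unary.All using (All)
open import Data.List.Relation.Unary.Linked using (Linked)
open import Data.List.Relation.Unary.Unique.Propositional using (Unique)
open import Data.List.Membership.Propositional using (_∈_)
open import Data.Product using (Σ; _×_; ∃)
open import Data.Sum using (_⊎_)
open import Relation.Binary.PropositionalEquality using (_≡_)

StepOK : ℕ → ℕ → Set
StepOK x y = x ≡ y ⊎ x ≡ suc y

-- A partition is a list q_1 ∷ … ∷ q_h of positive parts; the weak decrease
-- q_1 ≥ … ≥ q_h is part of (implied by) Linked StepOK.
Counted : ℕ → List ℕ → Set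
Counted n q =
  All (λ x → 0 < x) q
  × sum q ≡ n
  × 4 ≤ length q
  × Linked StepOK q
  × Σ ℕ (λ a → Σ (List ℕ) (λ r → q ≡ a ∷ a ∷ r))
  × Σ (List ℕ) (λ xs → q ≡ xs ++ (3 ∷ 2 ∷ 1 ∷ []))

EvenCounted : ℕ → List ℕ → Set
EvenCounted n q = Counted n q × length q % 2 ≡ 0

OddCounted : ℕ → List ℕ → Set
OddCounted n q = Counted n q × length q % 2 ≡ 1

HasCount : (List ℕ → Set) → ℕ → Set
HasCount P k =
  Σ (List (List ℕ)) λ L →
    Unique L × (∀ q → (q ∈ L → P q) × (P q → q ∈ L)) × length L ≡ k

-- The four exceptional forms (t an integer ≥ 2); written as 2n = ...
FormA : ℕ → Set
FormA n = Σ ℕ λ t → 2 ≤ t × 2 * n ≡ 3 * t ^ 2 + t + 4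

FormB : ℕ → Set
FormB n = Σ ℕ λ t → 2 ≤ t × 2 * n ≡ 3 * (t + 1) ^ 2 ∸ t ∸ 1

FormC : ℕ → Set
FormC n = Σ ℕ λ t → 2 ≤ t × 2 * n ≡ 3 * (t + 1) ^ 2 + 3 ∸ t

FormD : ℕ → Set
FormD n = Σ ℕ λ t → 2 ≤ t × 2 * n ≡ 3 * (t + 1) ^ 2 + t + 1

module Submission where

-- Conjugation is a bijection between the counted partitions of n and the partitions of n into
-- distinct parts, the smallest at least 2 and the three largest consecutive; it turns the number
-- of parts into the largest part, so e'(n) − o'(n) counts these partitions with the sign of the
-- parity of their largest part. Removing a smallest part 2 leaves the analogous partitions of
-- n − 2 with smallest part at least 3, apart from (4, 3, 2) when n = 9. On partitions with
-- smallest part at least 3 and consecutive three largest parts, Franklin's involution (spread the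
-- smallest part over the largest parts, or gather the initial run of consecutive parts into a new
-- smallest part) changes the largest part by one, and its fixed points are the staircases
-- (2k, …, k + 1) and (2k − 1, …, k), k ≥ 3, of sizes k(3k ± 1)/2. Hence e'(n) − o'(n) is [n = 9]
-- plus signed pentagonal indicators of n − 2 and n, and since pentagonal numbers of index at least
-- 3 are more than 2 apart, at most one of these terms is non-zero.

open import Defs
open import Data.Nat
  using (ℕ; zero; suc; pred; >-nonZero; _+_; _*_; _∸_; _^_; _%_; _≤_; _<_; _>_; z≤n; s≤s; _≟_; _≤?_; _<?_)
open import Data.Nat.Properties
open import Data.Nat.ListAction using (sum)
open import Data.Nat.DivMod using ([m+n]%n≡m%n; [m+kn]%n≡m%n; m*n%n≡0; m%n<n)
open import Data.Nat.ListAction.Properties using (sum-++; sum-↭)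
open import Data.Nat.Tactic.RingSolver using (solve-∀)
open import Data.List using (List; []; _∷_; _++_; _∷ʳ_; length; filter; map; replicate; reverse; reverseAcc)
open import Data.List.Relation.Unary.Linked as Linked using (Linked; []; [-]; _∷_; linked?)
open import Data.List.Relation.Unary.Linked.Properties using (Linked⇒All)
open import Data.List.Properties
  using ( ∷-injectiveʳ; ++-identityʳ; length-map; map-∘; map-id-local; length-++; length-replicate
        ; length-reverse; reverse-++; reverse-involutive)
open import Data.List.Relation.Unary.All as All using (All; []; _∷_)
open import Data.List.Relation.Unary.Unique.Propositional using (Unique; []; _∷_)
import Data.List.Relation.Unary.Unique.Propositional.Properties as Unique
open import Data.List.Membership.Propositional using (_∈_)
open import Data.List.Membership.Propositional.Properties
  using (∈-filter⁺; ∈-filter⁻; ∈-map⁺; ∈-map⁻; ∈-++⁺ˡ; ∈-++⁺ʳ; ∈-++⁻)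
open import Data.List.Membership.Propositional.Properties.WithK using (unique∧set⇒bag)
open import Data.List.Relation.Binary.BagAndSetEquality using (∼bag⇒↭)
open import Data.List.Relation.Binary.Permutation.Propositional using (↭-sym)
open import Data.List.Relation.Binary.Permutation.Propositional.Properties using (↭-length; ↭-reverse; All-resp-↭)
import Data.List.Relation.Unary.All.Properties as AllP
open import Data.List.Relation.Unary.Any using (here; there)
open import Data.Product using (Σ; _×_; _,_; proj₁; proj₂)
open import Data.Sum as Sum using (_⊎_; inj₁; inj₂)
open import Data.Empty using (⊥; ⊥-elim)
open import Function.Base using (flip; id; _∘_)
open import Function.Bundles using (_⇔_; mk⇔; module Equivalence)
open import Relation.Nullary using (¬_; Dec; yes; no)
open import Relation.Nullary.Decidable using (_×-dec_; _⊎-dec_; from-no)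
open import Relation.Unary using (Decidable; ∁; _∩_)
open import Relation.Unary.Properties using (_∩?_; ∁?)
open import Relation.Binary.Definitions using (tri<; tri≈; tri>)
open import Relation.Binary.PropositionalEquality

open Equivalence using (to; from)

-- Counting finite sets of lists

hasCount-filter : ∀ {P : List ℕ → Set} (P? : Decidable P) {xs : List (List ℕ)} → Unique xs →
  (∀ {μ} → P μ → μ ∈ xs) → HasCount P (length (filter P? xs))
hasCount-filter P? {xs} u complete = filter P? xs , Unique.filter⁺ P? u ,
  (λ μ → (λ μ∈ → proj₂ (∈-filter⁻ P? {xs = xs} μ∈)) , (λ p → ∈-filter⁺ P? (complete p) p)) , refl

hasCount-unique : ∀ {P Q : List ℕ → Set} {a b} → HasCount P a → HasCount Q b →
  (∀ {μ} → P μ → Q μ) → (∀ {μ} → Q μ → P μ) → a ≡ b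
hasCount-unique (xs , u , mem , refl) (ys , v , mem′ , refl) P⇒Q Q⇒P =
  ↭-length (∼bag⇒↭ (unique∧set⇒bag u v λ {μ} → mk⇔
    (λ μ∈ → proj₂ (mem′ μ) (P⇒Q (proj₁ (mem μ) μ∈)))
    (λ μ∈ → proj₂ (mem μ) (Q⇒P (proj₁ (mem′ μ) μ∈)))))

hasCount-bijection : ∀ {P Q : List ℕ → Set} {a} → HasCount P a → (f g : List ℕ → List ℕ) →
  (∀ {μ} → P μ → Q (f μ)) → (∀ {ν} → Q ν → P (g ν)) →
  (∀ {μ} → P μ → g (f μ) ≡ μ) → (∀ {ν} → Q ν → f (g ν) ≡ ν) → HasCount Q a
hasCount-bijection {P} {Q} (xs , u , mem , refl) f g P⇒Q Q⇒P gf fg =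
  map f xs , Unique.map⁻ (subst Unique (sym g∘f≡id) u) , mem′ , length-map f xs
  where
  g∘f≡id : map g (map f xs) ≡ xs
  g∘f≡id = trans (sym (map-∘ xs)) (map-id-local (All.tabulate (λ μ∈ → gf (proj₁ (mem _) μ∈))))
  image⇒Q : ∀ {ν} → ν ∈ map f xs → Q ν
  image⇒Q ν∈ with ∈-map⁻ f ν∈
  ... | μ , μ∈ , refl = P⇒Q (proj₁ (mem μ) μ∈)
  mem′ : ∀ ν → (ν ∈ map f xs → Q ν) × (Q ν → ν ∈ map f xs)
  mem′ ν = image⇒Q , λ q → subst (_∈ map f xs) (fg q) (∈-map⁺ f (proj₂ (mem (g ν)) (Q⇒P q)))

hasCount-empty : ∀ {P : List ℕ → Set} {c} → HasCount P c → (∀ {μ} → ¬ P μ) → c ≡ 0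
hasCount-empty ([] , _ , _ , refl) _ = refl
hasCount-empty (μ ∷ _ , _ , mem , refl) none = ⊥-elim (none (proj₁ (mem μ) (here refl)))

hasCount-singleton : ∀ {P : List ℕ → Set} {c ν} → HasCount P c → P ν → (∀ {μ} → P μ → μ ≡ ν) → c ≡ 1
hasCount-singleton ([] , _ , mem , refl) p _ with proj₂ (mem _) p
... | ()
hasCount-singleton (_ ∷ [] , _ , _ , refl) _ _ = refl
hasCount-singleton (μ ∷ μ′ ∷ _ , (μ∉ ∷ _) , mem , refl) _ only =
  ⊥-elim (All.head μ∉ (trans (only (proj₁ (mem μ) (here refl))) (sym (only (proj₁ (mem μ′) (there (here refl)))))))

length-filter-split : ∀ {A : Set} {P R : A → Set} (P? : Decidable P) (R? : Decidable R) xs →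
  length (filter P? xs) ≡ length (filter (P? ∩? R?) xs) + length (filter (P? ∩? ∁? R?) xs)
length-filter-split P? R? [] = refl
length-filter-split P? R? (x ∷ xs) with P? x | R? x
... | yes _ | yes _ = cong suc (length-filter-split P? R? xs)
... | yes _ | no _ = trans (cong suc (length-filter-split P? R? xs)) (sym (+-suc _ _))
... | no _ | _ = length-filter-split P? R? xs

-- Partitions into distinct parts

StrictlyDecreasing : List ℕ → Set
StrictlyDecreasing = Linked _>_

largest : List ℕ → ℕ
largest [] = 0
largest (x ∷ _) = x

smallest : List ℕ → ℕ
smallest [] = 0
smallest (x ∷ []) = x
smallest (_ ∷ y ∷ ys) = smallest (y ∷ ys)

decreasing-below-head : ∀ {x xs} → StrictlyDecreasing (x ∷ xs) → All (_< x) xs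
decreasing-below-head [-] = []
decreasing-below-head (x>y ∷ d) = Linked⇒All (λ x>y y>z → <-trans y>z x>y) x>y d

decreasing-smallest≤head : ∀ {x xs} → StrictlyDecreasing (x ∷ xs) → smallest (x ∷ xs) ≤ x
decreasing-smallest≤head [-] = ≤-refl
decreasing-smallest≤head (x>y ∷ d) = ≤-trans (decreasing-smallest≤head d) (<⇒≤ x>y)

decreasing-all≥smallest : ∀ xs → StrictlyDecreasing xs → All (smallest xs ≤_) xs
decreasing-all≥smallest [] _ = []
decreasing-all≥smallest (x ∷ []) _ = ≤-refl ∷ []
decreasing-all≥smallest (x ∷ y ∷ ys) d@(_ ∷ d′) =
  decreasing-smallest≤head d ∷ decreasing-all≥smallest (y ∷ ys) d′

distinctPartLists : ℕ → List (List ℕ)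
distinctPartLists zero = [] ∷ []
distinctPartLists (suc k) = map (suc k ∷_) (distinctPartLists k) ++ distinctPartLists k

distinctPartLists-bounded : ∀ k {μ} → μ ∈ distinctPartLists k → All (_≤ k) μ
distinctPartLists-bounded zero (here refl) = []
distinctPartLists-bounded (suc k) μ∈ with ∈-++⁻ (map (suc k ∷_) (distinctPartLists k)) μ∈
... | inj₂ μ∈′ = All.map m≤n⇒m≤1+n (distinctPartLists-bounded k μ∈′)
... | inj₁ μ∈′ with ∈-map⁻ (suc k ∷_) μ∈′
...   | ν , ν∈ , refl = ≤-refl ∷ All.map m≤n⇒m≤1+n (distinctPartLists-bounded k ν∈)

distinctPartLists-unique : ∀ k → Unique (distinctPartLists k)
distinctPartLists-unique zero = [] ∷ []
distinctPartLists-unique (suc k) =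
  Unique.++⁺ (Unique.map⁺ (λ { refl → refl }) (distinctPartLists-unique k)) (distinctPartLists-unique k) disjoint
  where
  disjoint : ∀ {μ} → μ ∈ map (suc k ∷_) (distinctPartLists k) × μ ∈ distinctPartLists k → ⊥
  disjoint (μ∈ , μ∈′) with ∈-map⁻ (suc k ∷_) μ∈
  ... | _ , _ , refl with distinctPartLists-bounded k μ∈′
  ...   | 1+k≤k ∷ _ = 1+n≰n 1+k≤k

distinctPartLists-complete : ∀ k {μ} → StrictlyDecreasing μ → All (λ y → 1 ≤ y × y ≤ k) μ →
  μ ∈ distinctPartLists k
distinctPartLists-complete zero {[]} _ _ = here refl
distinctPartLists-complete zero {_ ∷ _} _ ((1≤x , x≤0) ∷ _) = ⊥-elim (<⇒≱ 1≤x x≤0)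
distinctPartLists-complete (suc k) {[]} _ _ =
  ∈-++⁺ʳ (map (suc k ∷_) (distinctPartLists k)) (distinctPartLists-complete k [] [])
distinctPartLists-complete (suc k) {x ∷ μ} d ((1≤x , x≤1+k) ∷ bounds) with x ≟ suc k
... | yes refl = ∈-++⁺ˡ (∈-map⁺ (suc k ∷_) (distinctPartLists-complete k (Linked.tail d)
      (All.zipWith (λ ((1≤y , _) , y<x) → 1≤y , ≤-pred y<x) (bounds , decreasing-below-head d))))
... | no x≢1+k = ∈-++⁺ʳ (map (suc k ∷_) (distinctPartLists k)) (distinctPartLists-complete k d
      ((1≤x , x≤k) ∷ All.zipWith (λ ((1≤y , _) , y<x) → 1≤y , ≤-trans (<⇒≤ y<x) x≤k)
                                 (bounds , decreasing-below-head d)))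
  where
  x≤k : x ≤ k
  x≤k = ≤-pred (≤∧≢⇒< x≤1+k x≢1+k)

all≤sum : ∀ xs → All (_≤ sum xs) xs
all≤sum [] = []
all≤sum (x ∷ xs) = m≤m+n x (sum xs) ∷ All.map (λ y≤ → ≤-trans y≤ (m≤n+m (sum xs) x)) (all≤sum xs)

count : ∀ {P : List ℕ → Set} → Decidable P → ℕ → ℕ
count P? n = length (filter P? (distinctPartLists n))

hasCount-count : ∀ {P : List ℕ → Set} (P? : Decidable P) n →
  (∀ {μ} → P μ → StrictlyDecreasing μ × 1 ≤ smallest μ × sum μ ≡ n) → HasCount P (count P? n)
hasCount-count {P} P? n distinct = hasCount-filter P? (distinctPartLists-unique n) complete
  where
  complete : ∀ {μ} → P μ → μ ∈ distinctPartLists n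
  complete {μ} p with distinct p
  ... | d , 1≤s , refl = distinctPartLists-complete (sum μ) d
    (All.zipWith (λ (s≤y , y≤n) → ≤-trans 1≤s s≤y , y≤n) (decreasing-all≥smallest μ d , all≤sum μ))

count-split : ∀ {P R : List ℕ → Set} (P? : Decidable P) (R? : Decidable R) n →
  count P? n ≡ count (P? ∩? R?) n + count (P? ∩? ∁? R?) n
count-split P? R? n = length-filter-split P? R? (distinctPartLists n)

TopThreeConsecutive : List ℕ → Set
TopThreeConsecutive μ = Σ ℕ λ a → Σ (List ℕ) λ r → μ ≡ suc (suc a) ∷ suc a ∷ a ∷ r

Top3Distinct : ℕ → ℕ → List ℕ → Set
Top3Distinct b n μ = StrictlyDecreasing μ × TopThreeConsecutive μ × b ≤ smallest μ × sum μ ≡ n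

LargestParity : ℕ → List ℕ → Set
LargestParity p μ = largest μ % 2 ≡ p

topThreeConsecutive? : Decidable TopThreeConsecutive
topThreeConsecutive? [] = no λ ()
topThreeConsecutive? (x ∷ []) = no λ ()
topThreeConsecutive? (x ∷ y ∷ []) = no λ ()
topThreeConsecutive? (x ∷ y ∷ z ∷ r) with x ≟ suc y | y ≟ suc z
... | yes refl | yes refl = yes (z , r , refl)
... | no x≢1+y | _ = no λ { (_ , _ , refl) → x≢1+y refl }
... | yes _ | no y≢1+z = no λ { (_ , _ , refl) → y≢1+z refl }

top3Distinct? : ∀ b n → Decidable (Top3Distinct b n)
top3Distinct? b n μ =
  linked? (λ x y → y <? x) μ ×-dec topThreeConsecutive? μ ×-dec (b ≤? smallest μ) ×-dec (sum μ ≟ n)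

largestParity? : ∀ p → Decidable (LargestParity p)
largestParity? p μ = largest μ % 2 ≟ p

Top3DistinctParity : ℕ → ℕ → ℕ → List ℕ → Set
Top3DistinctParity b n p = Top3Distinct b n ∩ LargestParity p

top3DistinctParity? : ∀ b n p → Decidable (Top3DistinctParity b n p)
top3DistinctParity? b n p = top3Distinct? b n ∩? largestParity? p

countTop3 : ℕ → ℕ → ℕ → ℕ
countTop3 b n p = count (top3DistinctParity? b n p) n

hasCount-top3Distinct : ∀ {P : List ℕ → Set} (P? : Decidable P) b n → 1 ≤ b →
  (∀ {μ} → P μ → Top3Distinct b n μ) → HasCount P (count P? n)
hasCount-top3Distinct P? b n 1≤b P⇒ =
  hasCount-count P? n λ p → let (d , _ , b≤s , μ-sum) = P⇒ p in d , ≤-trans 1≤b b≤s , μ-sum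

-- Conjugation

TwoLargestEqual : List ℕ → Set
TwoLargestEqual q = Σ ℕ λ a → Σ (List ℕ) λ r → q ≡ a ∷ a ∷ r

replicate-suc-++ : ∀ {A : Set} d (k : A) γ → replicate (suc d) k ++ γ ≡ replicate d k ++ k ∷ γ
replicate-suc-++ zero k γ = refl
replicate-suc-++ (suc d) k γ = cong (k ∷_) (replicate-suc-++ d k γ)

reverse-replicate : ∀ {A : Set} d (k : A) → reverse (replicate d k) ≡ replicate d k
reverse-replicate zero k = refl
reverse-replicate (suc d) k = begin
  reverse (replicate (suc d) k)  ≡⟨ cong reverse (trans (sym (++-identityʳ _)) (replicate-suc-++ d k [])) ⟩
  reverse (replicate d k ++ k ∷ [])  ≡⟨ reverse-++ (replicate d k) (k ∷ []) ⟩
  k ∷ reverse (replicate d k)  ≡⟨ cong (k ∷_) (reverse-replicate d k) ⟩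
  replicate (suc d) k  ∎
  where open ≡-Reasoning

sum-replicate : ∀ d k → sum (replicate d k) ≡ d * k
sum-replicate zero k = refl
sum-replicate (suc d) k = cong (k +_) (sum-replicate d k)

sum-reverse : ∀ xs → sum (reverse xs) ≡ sum xs
sum-reverse xs = sum-↭ (↭-reverse xs)

All-reverse : ∀ {P : ℕ → Set} {xs} → All P xs → All P (reverse xs)
All-reverse {xs = xs} = All-resp-↭ (↭-sym (↭-reverse xs))

Linked-reverse : ∀ {R : ℕ → ℕ → Set} xs → Linked R xs → Linked (flip R) (reverse xs)
Linked-reverse [] _ = []
Linked-reverse (x ∷ xs) l = go x xs [] l [-]
  where
  go : ∀ {R : ℕ → ℕ → Set} x xs acc → Linked R (x ∷ xs) → Linked (flip R) (x ∷ acc) →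
    Linked (flip R) (reverseAcc (x ∷ acc) xs)
  go x [] acc _ acc↑ = acc↑
  go x (y ∷ ys) acc (Rxy ∷ l) acc↑ = go y ys (x ∷ acc) l (Rxy ∷ acc↑)

∸-suc : ∀ {x y} → y < x → Σ ℕ λ d → x ∸ y ≡ suc d
∸-suc {suc x} {zero} _ = x , refl
∸-suc {suc x} {suc y} (s≤s y<x) = ∸-suc y<x

-- The conjugate of μ in increasing order, with every part raised by k ∸ 1.
conjugateFrom : ℕ → List ℕ → List ℕ
conjugateFrom k [] = []
conjugateFrom k (x ∷ []) = replicate x k
conjugateFrom k (x ∷ y ∷ ys) = replicate (x ∸ y) k ++ conjugateFrom (suc k) (y ∷ ys)

conjugate : List ℕ → List ℕ
conjugate μ = reverse (conjugateFrom 1 μ)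

incrementLargest : List ℕ → List ℕ
incrementLargest [] = []
incrementLargest (x ∷ xs) = suc x ∷ xs

-- Takes the column heights in increasing order, as produced by conjugateFrom.
unconjugate : List ℕ → List ℕ
unconjugate [] = []
unconjugate (b ∷ []) = 1 ∷ []
unconjugate (b ∷ c ∷ β) = unconjugateStep (b ≟ c) (unconjugate (c ∷ β))
  where
  unconjugateStep : ∀ {P : Set} → Dec P → List ℕ → List ℕ
  unconjugateStep (yes _) μ = incrementLargest μ
  unconjugateStep (no _) μ = suc (largest μ) ∷ μ

length-conjugateFrom : ∀ k x xs → StrictlyDecreasing (x ∷ xs) → length (conjugateFrom k (x ∷ xs)) ≡ x
length-conjugateFrom k x [] _ = length-replicate x
length-conjugateFrom k x (y ∷ ys) (y<x ∷ d) = begin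
  length (replicate (x ∸ y) k ++ conjugateFrom (suc k) (y ∷ ys))
    ≡⟨ length-++ (replicate (x ∸ y) k) ⟩
  length (replicate (x ∸ y) k) + length (conjugateFrom (suc k) (y ∷ ys))
    ≡⟨ cong₂ _+_ (length-replicate (x ∸ y)) (length-conjugateFrom (suc k) y ys d) ⟩
  x ∸ y + y
    ≡⟨ m∸n+n≡m (<⇒≤ y<x) ⟩
  x ∎
  where open ≡-Reasoning

sum-conjugateFrom : ∀ j x xs → StrictlyDecreasing (x ∷ xs) →
  sum (conjugateFrom (suc j) (x ∷ xs)) ≡ sum (x ∷ xs) + j * x
sum-conjugateFrom j x [] _ = trans (sum-replicate x (suc j)) (regroup x j)
  where
  regroup : ∀ x j → x * suc j ≡ x + 0 + j * x
  regroup = solve-∀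
sum-conjugateFrom j x (y ∷ ys) (y<x ∷ d) = begin
  sum (replicate (x ∸ y) (suc j) ++ conjugateFrom (suc (suc j)) (y ∷ ys))
    ≡⟨ sum-++ (replicate (x ∸ y) (suc j)) _ ⟩
  sum (replicate (x ∸ y) (suc j)) + sum (conjugateFrom (suc (suc j)) (y ∷ ys))
    ≡⟨ cong₂ _+_ (sum-replicate (x ∸ y) (suc j)) (sum-conjugateFrom (suc j) y ys d) ⟩
  (x ∸ y) * suc j + (sum (y ∷ ys) + suc j * y)
    ≡⟨ regroup (x ∸ y) y (sum (y ∷ ys)) j ⟩
  (x ∸ y + y) + sum (y ∷ ys) + j * (x ∸ y + y)
    ≡⟨ cong (λ z → z + sum (y ∷ ys) + j * z) (m∸n+n≡m (<⇒≤ y<x)) ⟩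
  x + sum (y ∷ ys) + j * x ∎
  where
  open ≡-Reasoning
  regroup : ∀ d y S j → d * suc j + (S + suc j * y) ≡ (d + y) + S + j * (d + y)
  regroup = solve-∀

conjugateFrom-head : ∀ k x xs → StrictlyDecreasing (x ∷ xs) → 1 ≤ smallest (x ∷ xs) →
  Σ (List ℕ) λ β → conjugateFrom k (x ∷ xs) ≡ k ∷ β
conjugateFrom-head k (suc x) [] _ _ = replicate x k , refl
conjugateFrom-head k x (y ∷ ys) (y<x ∷ _) _ with ∸-suc y<x
... | d , x∸y≡1+d rewrite x∸y≡1+d = replicate d k ++ conjugateFrom (suc k) (y ∷ ys) , refl

replicate-++-steps : ∀ d k β → Linked (flip StepOK) (k ∷ β) → Linked (flip StepOK) (replicate d k ++ k ∷ β)
replicate-++-steps zero k β l = l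
replicate-++-steps (suc zero) k β l = inj₁ refl ∷ l
replicate-++-steps (suc (suc d)) k β l = inj₁ refl ∷ replicate-++-steps (suc d) k β l

conjugateFrom-steps : ∀ k μ → StrictlyDecreasing μ → 1 ≤ smallest μ → Linked (flip StepOK) (conjugateFrom k μ)
conjugateFrom-steps k [] _ _ = []
conjugateFrom-steps k (zero ∷ []) _ _ = []
conjugateFrom-steps k (suc x ∷ []) _ _ =
  subst (Linked (flip StepOK)) (trans (sym (replicate-suc-++ x k [])) (++-identityʳ _)) (replicate-++-steps x k [] [-])
conjugateFrom-steps k (x ∷ y ∷ ys) (y<x ∷ d) 1≤s
  with ∸-suc y<x | conjugateFrom-head (suc k) y ys d 1≤s | conjugateFrom-steps (suc k) (y ∷ ys) d 1≤s
... | e , x∸y≡1+e | β , β-eq | steps rewrite x∸y≡1+e | β-eq | replicate-suc-++ e k (suc k ∷ β) =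
  replicate-++-steps e k (suc k ∷ β) (inj₂ refl ∷ steps)

conjugateFrom-≥ : ∀ k μ → All (k ≤_) (conjugateFrom k μ)
conjugateFrom-≥ k [] = []
conjugateFrom-≥ k (x ∷ []) = AllP.replicate⁺ x ≤-refl
conjugateFrom-≥ k (x ∷ y ∷ ys) =
  AllP.++⁺ (AllP.replicate⁺ (x ∸ y) ≤-refl) (All.map (≤-trans (n≤1+n k)) (conjugateFrom-≥ (suc k) (y ∷ ys)))

unconjugate-replicate : ∀ d k → unconjugate (replicate (suc d) k) ≡ suc d ∷ []
unconjugate-replicate zero k = refl
unconjugate-replicate (suc d) k with k ≟ k
... | yes _ = cong incrementLargest (unconjugate-replicate d k)
... | no k≢k = ⊥-elim (k≢k refl)

unconjugate-replicate-++ : ∀ d k c β → k ≢ c →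
  unconjugate (replicate (suc d) k ++ c ∷ β) ≡ (suc d + largest (unconjugate (c ∷ β))) ∷ unconjugate (c ∷ β)
unconjugate-replicate-++ zero k c β k≢c with k ≟ c
... | yes k≡c = ⊥-elim (k≢c k≡c)
... | no _ = refl
unconjugate-replicate-++ (suc d) k c β k≢c with k ≟ k
... | yes _ = cong incrementLargest (unconjugate-replicate-++ d k c β k≢c)
... | no k≢k = ⊥-elim (k≢k refl)

unconjugate-conjugateFrom : ∀ k μ → StrictlyDecreasing μ → 1 ≤ smallest μ → unconjugate (conjugateFrom k μ) ≡ μ
unconjugate-conjugateFrom k [] _ _ = refl
unconjugate-conjugateFrom k (suc x ∷ []) _ _ = unconjugate-replicate x k
unconjugate-conjugateFrom k (x ∷ y ∷ ys) (y<x ∷ d) 1≤s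
  with ∸-suc y<x | conjugateFrom-head (suc k) y ys d 1≤s | unconjugate-conjugateFrom (suc k) (y ∷ ys) d 1≤s
... | e , x∸y≡1+e | β , β-eq | ih rewrite x∸y≡1+e | β-eq = begin
  unconjugate (replicate (suc e) k ++ suc k ∷ β)
    ≡⟨ unconjugate-replicate-++ e k (suc k) β (λ k≡1+k → 1+n≢n (sym k≡1+k)) ⟩
  (suc e + largest (unconjugate (suc k ∷ β))) ∷ unconjugate (suc k ∷ β)
    ≡⟨ cong (λ ν → (suc e + largest ν) ∷ ν) ih ⟩
  (suc e + y) ∷ y ∷ ys
    ≡⟨ cong (λ z → z + y ∷ y ∷ ys) (sym x∸y≡1+e) ⟩
  (x ∸ y + y) ∷ y ∷ ys
    ≡⟨ cong (_∷ y ∷ ys) (m∸n+n≡m (<⇒≤ y<x)) ⟩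
  x ∷ y ∷ ys ∎
  where open ≡-Reasoning

conjugateFrom-incrementLargest : ∀ k x xs → StrictlyDecreasing (x ∷ xs) →
  conjugateFrom k (suc x ∷ xs) ≡ k ∷ conjugateFrom k (x ∷ xs)
conjugateFrom-incrementLargest k x [] _ = refl
conjugateFrom-incrementLargest k x (y ∷ ys) (y<x ∷ _) rewrite +-∸-assoc 1 (<⇒≤ y<x) = refl

unconjugate-steps : ∀ k β → Linked (flip StepOK) (k ∷ β) → Σ ℕ λ x → Σ (List ℕ) λ xs →
  unconjugate (k ∷ β) ≡ x ∷ xs × StrictlyDecreasing (x ∷ xs) × 1 ≤ smallest (x ∷ xs) ×
  conjugateFrom k (x ∷ xs) ≡ k ∷ β
unconjugate-steps k [] _ = 1 , [] , refl , [-] , ≤-refl , refl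
unconjugate-steps k (c ∷ β) (k~c ∷ l) with k ≟ c
unconjugate-steps k (c ∷ β) (k~c ∷ l) | yes refl with unconjugate-steps k β l
... | x , xs , u≡ , d , 1≤s , c≡ rewrite u≡ =
  suc x , xs , refl , increment d , increment-smallest xs 1≤s ,
  trans (conjugateFrom-incrementLargest k x xs d) (cong (k ∷_) c≡)
  where
  increment : ∀ {x xs} → StrictlyDecreasing (x ∷ xs) → StrictlyDecreasing (suc x ∷ xs)
  increment [-] = [-]
  increment (y<x ∷ d) = m≤n⇒m≤1+n y<x ∷ d
  increment-smallest : ∀ xs → 1 ≤ smallest (x ∷ xs) → 1 ≤ smallest (suc x ∷ xs)
  increment-smallest [] _ = s≤s z≤n
  increment-smallest (_ ∷ _) 1≤s = 1≤s
unconjugate-steps k (c ∷ β) (inj₁ c≡k ∷ l) | no k≢c = ⊥-elim (k≢c (sym c≡k))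
unconjugate-steps k (.(suc k) ∷ β) (inj₂ refl ∷ l) | no _ with unconjugate-steps (suc k) β l
... | y , ys , u≡ , d , 1≤s , c≡ rewrite u≡ =
  suc y , y ∷ ys , refl , n<1+n y ∷ d , 1≤s ,
  trans (cong (λ e → replicate e k ++ conjugateFrom (suc k) (y ∷ ys)) (m+n∸n≡m 1 y)) (cong (k ∷_) c≡)

reverse-conjugateFrom-∷ : ∀ k x y ys →
  reverse (conjugateFrom k (x ∷ y ∷ ys)) ≡ reverse (conjugateFrom (suc k) (y ∷ ys)) ++ replicate (x ∸ y) k
reverse-conjugateFrom-∷ k x y ys =
  trans (reverse-++ (replicate (x ∸ y) k) _) (cong (reverse (conjugateFrom (suc k) (y ∷ ys)) ++_) (reverse-replicate (x ∸ y) k))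

2≤smallest⇒twoLargestEqual : ∀ k μ → StrictlyDecreasing μ → 2 ≤ smallest μ →
  TwoLargestEqual (reverse (conjugateFrom k μ))
2≤smallest⇒twoLargestEqual k (suc (suc x) ∷ []) _ _ = k , replicate x k , reverse-replicate (suc (suc x)) k
2≤smallest⇒twoLargestEqual k (suc zero ∷ []) _ (s≤s ())
2≤smallest⇒twoLargestEqual k (x ∷ y ∷ ys) (_ ∷ d) 2≤s with 2≤smallest⇒twoLargestEqual (suc k) (y ∷ ys) d 2≤s
... | a , r , eq = a , r ++ replicate (x ∸ y) k , trans (reverse-conjugateFrom-∷ k x y ys) (cong (_++ replicate (x ∸ y) k) eq)

twoLargestEqual⇒2≤smallest : ∀ k μ → StrictlyDecreasing μ → 1 ≤ smallest μ →
  TwoLargestEqual (reverse (conjugateFrom k μ)) → 2 ≤ smallest μ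
twoLargestEqual⇒2≤smallest k [] _ _ (_ , _ , ())
twoLargestEqual⇒2≤smallest k (x ∷ []) _ _ (a , r , eq) = replicate-twoEqual x (trans (sym (reverse-replicate x k)) eq)
  where
  replicate-twoEqual : ∀ x → replicate x k ≡ a ∷ a ∷ r → 2 ≤ x
  replicate-twoEqual (suc (suc x)) _ = s≤s (s≤s z≤n)
twoLargestEqual⇒2≤smallest k (x ∷ zero ∷ []) _ () _
twoLargestEqual⇒2≤smallest k (x ∷ zero ∷ _ ∷ _) (_ ∷ () ∷ _) _ _
twoLargestEqual⇒2≤smallest k (x ∷ suc zero ∷ z ∷ zs) (_ ∷ z<1 ∷ d) 1≤s _ =
  ⊥-elim (<⇒≱ 1≤s (≤-trans (decreasing-smallest≤head d) (≤-pred z<1)))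
twoLargestEqual⇒2≤smallest k (x ∷ suc zero ∷ []) (1<x ∷ _) _ (a , r , eq) with ∸-suc 1<x
... | e , x∸1≡1+e = ⊥-elim (noTwoEqual (trans (cong (λ d → suc k ∷ replicate d k) (sym x∸1≡1+e))
                                   (trans (sym (reverse-conjugateFrom-∷ k x 1 [])) eq)))
  where
  noTwoEqual : suc k ∷ k ∷ replicate e k ≢ a ∷ a ∷ r
  noTwoEqual ()
twoLargestEqual⇒2≤smallest k (x ∷ suc (suc y) ∷ ys) (_ ∷ d) 1≤s (a , r , eq) =
  twoLargestEqual⇒2≤smallest (suc k) (suc (suc y) ∷ ys) d 1≤s
    (prefix (reverse (conjugateFrom (suc k) (suc (suc y) ∷ ys))) 2≤length
      (trans (sym (reverse-conjugateFrom-∷ k x (suc (suc y)) ys)) eq))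
  where
  2≤length : 2 ≤ length (reverse (conjugateFrom (suc k) (suc (suc y) ∷ ys)))
  2≤length = subst (2 ≤_)
    (sym (trans (length-reverse (conjugateFrom (suc k) (suc (suc y) ∷ ys))) (length-conjugateFrom (suc k) _ ys d)))
    (s≤s (s≤s z≤n))
  prefix : ∀ R {S} → 2 ≤ length R → R ++ S ≡ a ∷ a ∷ r → TwoLargestEqual R
  prefix (_ ∷ _ ∷ R) _ refl = a , R , refl
  prefix (_ ∷ []) (s≤s ()) _

conjugateFrom-step⇒ : ∀ k x xs δ → StrictlyDecreasing (x ∷ xs) → conjugateFrom k (x ∷ xs) ≡ k ∷ suc k ∷ δ →
  Σ ℕ λ y → Σ (List ℕ) λ ys → xs ≡ y ∷ ys × x ≡ suc y × conjugateFrom (suc k) (y ∷ ys) ≡ suc k ∷ δ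
conjugateFrom-step⇒ k (suc (suc x)) [] δ _ ()
conjugateFrom-step⇒ k x (y ∷ ys) δ (y<x ∷ _) eq with ∸-suc y<x
... | e , x∸y≡1+e =
  unfold e x∸y≡1+e (subst (λ d → replicate d k ++ conjugateFrom (suc k) (y ∷ ys) ≡ k ∷ suc k ∷ δ) x∸y≡1+e eq)
  where
  unfold : ∀ e → x ∸ y ≡ suc e → replicate (suc e) k ++ conjugateFrom (suc k) (y ∷ ys) ≡ k ∷ suc k ∷ δ →
    Σ ℕ λ y′ → Σ (List ℕ) λ ys′ →
      y ∷ ys ≡ y′ ∷ ys′ × x ≡ suc y′ × conjugateFrom (suc k) (y′ ∷ ys′) ≡ suc k ∷ δ
  unfold zero x∸y≡1 eq′ = y , ys , refl , trans (sym (m∸n+n≡m (<⇒≤ y<x))) (cong (_+ y) x∸y≡1) , ∷-injectiveʳ eq′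
  unfold (suc e) _ ()

top3⇒conjugate-123 : ∀ a r → StrictlyDecreasing (suc (suc a) ∷ suc a ∷ a ∷ r) → 1 ≤ smallest (a ∷ r) →
  Σ (List ℕ) λ γ → conjugateFrom 1 (suc (suc a) ∷ suc a ∷ a ∷ r) ≡ 1 ∷ 2 ∷ 3 ∷ γ
top3⇒conjugate-123 a r (_ ∷ _ ∷ d) 1≤s with conjugateFrom-head 3 a r d 1≤s
... | γ , eq = γ , trans (cong₂ (λ d e → replicate d 1 ++ replicate e 2 ++ conjugateFrom 3 (a ∷ r))
                                (m+n∸n≡m 1 (suc a)) (m+n∸n≡m 1 a))
                         (cong (λ ν → 1 ∷ 2 ∷ ν) eq)

conjugate-123⇒top3 : ∀ μ → StrictlyDecreasing μ → (Σ (List ℕ) λ γ → conjugateFrom 1 μ ≡ 1 ∷ 2 ∷ 3 ∷ γ) →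
  TopThreeConsecutive μ
conjugate-123⇒top3 [] _ (_ , ())
conjugate-123⇒top3 (x ∷ xs) d (γ , eq) with conjugateFrom-step⇒ 1 x xs (3 ∷ γ) d eq
... | y , ys , refl , refl , eq′ with conjugateFrom-step⇒ 2 y ys γ (Linked.tail d) eq′
...   | z , zs , refl , refl , _ = z , zs , refl

length-conjugate : ∀ μ → StrictlyDecreasing μ → length (conjugate μ) ≡ largest μ
length-conjugate [] _ = refl
length-conjugate (x ∷ xs) d = trans (length-reverse (conjugateFrom 1 (x ∷ xs))) (length-conjugateFrom 1 x xs d)

conjugate-counted : ∀ {n μ} → Top3Distinct 2 n μ → Counted n (conjugate μ)
conjugate-counted {n} {μ} (d , (a , r , refl) , 2≤s , μ-sum) =
  All-reverse (conjugateFrom-≥ 1 μ) ,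
  trans (sum-reverse (conjugateFrom 1 μ)) (trans (sum-conjugateFrom 0 _ _ d) (trans (+-identityʳ _) μ-sum)) ,
  subst (4 ≤_) (sym (length-conjugate μ d)) (s≤s (s≤s 2≤a)) ,
  Linked-reverse (conjugateFrom 1 μ) (conjugateFrom-steps 1 μ d 1≤s) ,
  2≤smallest⇒twoLargestEqual 1 μ d 2≤s ,
  suffix (top3⇒conjugate-123 a r d 1≤s)
  where
  1≤s : 1 ≤ smallest μ
  1≤s = ≤-trans (s≤s z≤n) 2≤s
  2≤a : 2 ≤ a
  2≤a = ≤-trans 2≤s (decreasing-smallest≤head (Linked.tail (Linked.tail d)))
  suffix : (Σ (List ℕ) λ γ → conjugateFrom 1 μ ≡ 1 ∷ 2 ∷ 3 ∷ γ) →
    Σ (List ℕ) λ xs → conjugate μ ≡ xs ++ 3 ∷ 2 ∷ 1 ∷ []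
  suffix (γ , eq) = reverse γ , trans (cong reverse eq) (reverse-++ (1 ∷ 2 ∷ 3 ∷ []) γ)

reverse-321 : ∀ {q} xs → q ≡ xs ++ 3 ∷ 2 ∷ 1 ∷ [] → reverse q ≡ 1 ∷ 2 ∷ 3 ∷ reverse xs
reverse-321 xs refl = reverse-++ xs (3 ∷ 2 ∷ 1 ∷ [])

counted-unconjugate : ∀ {n q} → Counted n q →
  Top3Distinct 2 n (unconjugate (reverse q)) × conjugate (unconjugate (reverse q)) ≡ q
counted-unconjugate {n} {q} (_ , q-sum , _ , steps , twoEqual , (xs , q≡))
  with unconjugate-steps 1 (2 ∷ 3 ∷ reverse xs) (subst (Linked (flip StepOK)) (reverse-321 xs q≡) (Linked-reverse q steps))
... | x , ys , unconj≡ , d , 1≤s , conjugateFrom≡ =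
  subst (λ ν → Top3Distinct 2 n ν × conjugate ν ≡ q) (sym (trans (cong unconjugate (reverse-321 xs q≡)) unconj≡))
    (top3 , conj≡)
  where
  open ≡-Reasoning
  conj≡ : conjugate (x ∷ ys) ≡ q
  conj≡ = trans (cong reverse (trans conjugateFrom≡ (sym (reverse-321 xs q≡)))) (reverse-involutive q)
  μ-sum : sum (x ∷ ys) ≡ n
  μ-sum = begin
    sum (x ∷ ys)  ≡⟨ sym (+-identityʳ (sum (x ∷ ys))) ⟩
    sum (x ∷ ys) + 0 * x  ≡⟨ sym (sum-conjugateFrom 0 x ys d) ⟩
    sum (conjugateFrom 1 (x ∷ ys))  ≡⟨ sym (sum-reverse (conjugateFrom 1 (x ∷ ys))) ⟩
    sum (conjugate (x ∷ ys))  ≡⟨ cong sum conj≡ ⟩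
    sum q  ≡⟨ q-sum ⟩
    n  ∎
  top3 : Top3Distinct 2 n (x ∷ ys)
  top3 = d , conjugate-123⇒top3 (x ∷ ys) d (reverse xs , conjugateFrom≡) ,
         twoLargestEqual⇒2≤smallest 1 (x ∷ ys) d 1≤s (subst TwoLargestEqual (sym conj≡) twoEqual) , μ-sum

hasCount-conjugate : ∀ n p {c} → HasCount (Top3DistinctParity 2 n p) c →
  HasCount (λ q → Counted n q × length q % 2 ≡ p) c
hasCount-conjugate n p h = hasCount-bijection h conjugate (λ q → unconjugate (reverse q))
  (λ {μ} (top3 , parity) → conjugate-counted top3 , trans (cong (_% 2) (length-conjugate μ (proj₁ top3))) parity)
  (λ {q} (c , parity) → let (top3 , conj≡) = counted-unconjugate c in
     top3 , trans (cong (_% 2) (trans (sym (length-conjugate _ (proj₁ top3))) (cong length conj≡))) parity)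
  (λ {μ} ((d , _ , 2≤s , _) , _) →
     trans (cong unconjugate (reverse-involutive (conjugateFrom 1 μ)))
           (unconjugate-conjugateFrom 1 μ d (≤-trans (s≤s z≤n) 2≤s)))
  (λ (c , _) → proj₂ (counted-unconjugate c))

-- Franklin's involution

topRun : List ℕ → ℕ
topRun [] = 0
topRun (x ∷ []) = 1
topRun (x ∷ y ∷ ys) = topRunStep (x ≟ suc y) (topRun (y ∷ ys))
  where
  topRunStep : ∀ {P : Set} → Dec P → ℕ → ℕ
  topRunStep (yes _) r = suc r
  topRunStep (no _) r = 1

dropLast : List ℕ → List ℕ
dropLast [] = []
dropLast (x ∷ []) = []
dropLast (x ∷ y ∷ ys) = x ∷ dropLast (y ∷ ys)

incrementFirst : ℕ → List ℕ → List ℕ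
incrementFirst zero xs = xs
incrementFirst (suc k) [] = []
incrementFirst (suc k) (x ∷ xs) = suc x ∷ incrementFirst k xs

decrementFirst : ℕ → List ℕ → List ℕ
decrementFirst zero xs = xs
decrementFirst (suc k) [] = []
decrementFirst (suc k) (x ∷ xs) = pred x ∷ decrementFirst k xs

topRun-cases : ∀ x y ys →
  (x ≡ suc y × topRun (x ∷ y ∷ ys) ≡ suc (topRun (y ∷ ys))) ⊎ (x ≢ suc y × topRun (x ∷ y ∷ ys) ≡ 1)
topRun-cases x y ys with x ≟ suc y
... | yes x≡1+y = inj₁ (x≡1+y , refl)
... | no x≢1+y = inj₂ (x≢1+y , refl)

topRun-consecutive : ∀ {x y} ys → x ≡ suc y → topRun (x ∷ y ∷ ys) ≡ suc (topRun (y ∷ ys))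
topRun-consecutive {x} {y} ys x≡1+y with topRun-cases x y ys
... | inj₁ (_ , r≡) = r≡
... | inj₂ (x≢1+y , _) = ⊥-elim (x≢1+y x≡1+y)

topRun-gap : ∀ {x y} ys → x ≢ suc y → topRun (x ∷ y ∷ ys) ≡ 1
topRun-gap {x} {y} ys x≢1+y with topRun-cases x y ys
... | inj₁ (x≡1+y , _) = ⊥-elim (x≢1+y x≡1+y)
... | inj₂ (_ , r≡) = r≡

topRun-≥2 : ∀ {x y} ys {k} → suc (suc k) ≤ topRun (x ∷ y ∷ ys) → x ≡ suc y × suc k ≤ topRun (y ∷ ys)
topRun-≥2 {x} {y} ys 2+k≤r with topRun-cases x y ys
... | inj₁ (x≡1+y , r≡) = x≡1+y , ≤-pred (subst (_ ≤_) r≡ 2+k≤r)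
... | inj₂ (_ , r≡) with subst (_ ≤_) r≡ 2+k≤r
...   | s≤s ()

topRun-positive : ∀ x xs → 1 ≤ topRun (x ∷ xs)
topRun-positive x [] = ≤-refl
topRun-positive x (y ∷ ys) with topRun-cases x y ys
... | inj₁ (_ , r≡) = subst (1 ≤_) (sym r≡) (s≤s z≤n)
... | inj₂ (_ , r≡) = ≤-reflexive (sym r≡)

topRun≤length : ∀ xs → topRun xs ≤ length xs
topRun≤length [] = z≤n
topRun≤length (x ∷ []) = ≤-refl
topRun≤length (x ∷ y ∷ ys) with topRun-cases x y ys | topRun≤length (y ∷ ys)
... | inj₁ (_ , r≡) | ih = subst (_≤ length (x ∷ y ∷ ys)) (sym r≡) (s≤s ih)
... | inj₂ (_ , r≡) | _ = subst (_≤ length (x ∷ y ∷ ys)) (sym r≡) (s≤s z≤n)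

topRun-top3 : ∀ a r → 3 ≤ topRun (suc (suc a) ∷ suc a ∷ a ∷ r)
topRun-top3 a r rewrite topRun-consecutive (a ∷ r) (refl {x = suc (suc a)}) | topRun-consecutive r (refl {x = suc a}) =
  s≤s (s≤s (topRun-positive a r))

topRun-++ : ∀ xs ys → topRun xs ≤ topRun (xs ++ ys)
topRun-++ [] ys = z≤n
topRun-++ (x ∷ []) [] = ≤-refl
topRun-++ (x ∷ []) (y ∷ ys) = topRun-positive x (y ∷ ys)
topRun-++ (x ∷ y ∷ ys) zs with topRun-cases x y ys | topRun-cases x y (ys ++ zs) | topRun-++ (y ∷ ys) zs
... | inj₁ (_ , r≡) | inj₁ (_ , r≡′) | ih rewrite r≡ | r≡′ = s≤s ih
... | inj₁ (x≡1+y , _) | inj₂ (x≢1+y , _) | _ = ⊥-elim (x≢1+y x≡1+y)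
... | inj₂ (_ , r≡) | _ | _ rewrite r≡ = topRun-positive x (y ∷ ys ++ zs)

topRun-incrementFirst : ∀ k ν → StrictlyDecreasing ν → 1 ≤ k → k ≤ length ν → k ≤ topRun ν →
  topRun (incrementFirst k ν) ≡ k
topRun-incrementFirst (suc zero) (x ∷ []) _ _ _ _ = refl
topRun-incrementFirst (suc zero) (x ∷ y ∷ ys) (y<x ∷ _) _ _ _ =
  topRun-gap ys (λ 1+x≡1+y → <⇒≢ y<x (sym (suc-injective 1+x≡1+y)))
topRun-incrementFirst (suc (suc k)) (x ∷ []) _ _ (s≤s ()) _
topRun-incrementFirst (suc (suc k)) (x ∷ y ∷ ys) (_ ∷ d) _ (s≤s k≤len) k≤r with topRun-≥2 ys k≤r
... | x≡1+y , k≤r′ = trans (topRun-consecutive {suc x} {suc y} (incrementFirst k ys) (cong suc x≡1+y))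
                          (cong suc (topRun-incrementFirst (suc k) (y ∷ ys) d (s≤s z≤n) k≤len k≤r′))

topRun-dropLast : ∀ k μ → k ≤ topRun μ → k < length μ → k ≤ topRun (dropLast μ)
topRun-dropLast zero μ _ _ = z≤n
topRun-dropLast (suc zero) (x ∷ []) _ (s≤s ())
topRun-dropLast (suc zero) (x ∷ y ∷ ys) _ _ = topRun-positive x (dropLast (y ∷ ys))
topRun-dropLast (suc (suc k)) (x ∷ y ∷ []) _ (s≤s (s≤s ()))
topRun-dropLast (suc (suc k)) (x ∷ y ∷ z ∷ zs) k≤r (s≤s k<len) with topRun-≥2 (z ∷ zs) k≤r
... | x≡1+y , k≤r′ rewrite topRun-consecutive (dropLast (z ∷ zs)) x≡1+y =
  s≤s (topRun-dropLast (suc k) (y ∷ z ∷ zs) k≤r′ k<len)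

topRun-decrementFirst : ∀ k xs → k ≤ topRun xs → All (1 ≤_) xs → k ≤ topRun (decrementFirst k xs)
topRun-decrementFirst zero xs _ _ = z≤n
topRun-decrementFirst (suc zero) (x ∷ xs) _ _ = topRun-positive (pred x) (decrementFirst 0 xs)
topRun-decrementFirst (suc (suc k)) (x ∷ []) (s≤s ()) _
topRun-decrementFirst (suc (suc k)) (x ∷ zero ∷ ys) _ (_ ∷ () ∷ _)
topRun-decrementFirst (suc (suc k)) (x ∷ suc y ∷ ys) k≤r (_ ∷ pos) =
  subst (suc (suc k) ≤_) (sym (topRun-consecutive {y = y} (decrementFirst k ys) (cong pred (proj₁ (topRun-≥2 ys k≤r)))))
    (s≤s (topRun-decrementFirst (suc k) (suc y ∷ ys) (proj₂ (topRun-≥2 ys k≤r)) pos))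

dropLast-∷ʳ-smallest : ∀ x xs → dropLast (x ∷ xs) ∷ʳ smallest (x ∷ xs) ≡ x ∷ xs
dropLast-∷ʳ-smallest x [] = refl
dropLast-∷ʳ-smallest x (y ∷ ys) = cong (x ∷_) (dropLast-∷ʳ-smallest y ys)

dropLast-∷ʳ : ∀ xs x → dropLast (xs ∷ʳ x) ≡ xs
dropLast-∷ʳ [] x = refl
dropLast-∷ʳ (y ∷ []) x = refl
dropLast-∷ʳ (y ∷ z ∷ zs) x = cong (y ∷_) (dropLast-∷ʳ (z ∷ zs) x)

smallest-∷ʳ : ∀ xs x → smallest (xs ∷ʳ x) ≡ x
smallest-∷ʳ [] x = refl
smallest-∷ʳ (y ∷ []) x = refl
smallest-∷ʳ (y ∷ z ∷ zs) x = smallest-∷ʳ (z ∷ zs) x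

length-dropLast : ∀ x xs → suc (length (dropLast (x ∷ xs))) ≡ length (x ∷ xs)
length-dropLast x [] = refl
length-dropLast x (y ∷ ys) = cong suc (length-dropLast y ys)

sum-dropLast : ∀ x xs → sum (dropLast (x ∷ xs)) + smallest (x ∷ xs) ≡ sum (x ∷ xs)
sum-dropLast x [] = +-comm 0 x
sum-dropLast x (y ∷ ys) = trans (+-assoc x _ _) (cong (x +_) (sum-dropLast y ys))

decreasing-dropLast : ∀ xs → StrictlyDecreasing xs → StrictlyDecreasing (dropLast xs)
decreasing-dropLast [] _ = []
decreasing-dropLast (x ∷ []) _ = []
decreasing-dropLast (x ∷ y ∷ []) _ = [-]
decreasing-dropLast (x ∷ y ∷ z ∷ zs) (y<x ∷ d) = y<x ∷ decreasing-dropLast (y ∷ z ∷ zs) d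

smallest<smallest-dropLast : ∀ x y ys → StrictlyDecreasing (x ∷ y ∷ ys) →
  smallest (x ∷ y ∷ ys) < smallest (dropLast (x ∷ y ∷ ys))
smallest<smallest-dropLast x y [] (y<x ∷ _) = y<x
smallest<smallest-dropLast x y (z ∷ zs) (_ ∷ d) = smallest<smallest-dropLast y z zs d

decreasing-∷ʳ : ∀ xs z → StrictlyDecreasing xs → 1 ≤ length xs → z < smallest xs → StrictlyDecreasing (xs ∷ʳ z)
decreasing-∷ʳ (x ∷ []) z _ _ z<x = z<x ∷ [-]
decreasing-∷ʳ (x ∷ y ∷ ys) z (y<x ∷ d) _ z<s = y<x ∷ decreasing-∷ʳ (y ∷ ys) z d (s≤s z≤n) z<s

length-incrementFirst : ∀ k xs → length (incrementFirst k xs) ≡ length xs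
length-incrementFirst zero xs = refl
length-incrementFirst (suc k) [] = refl
length-incrementFirst (suc k) (x ∷ xs) = cong suc (length-incrementFirst k xs)

length-decrementFirst : ∀ k xs → length (decrementFirst k xs) ≡ length xs
length-decrementFirst zero xs = refl
length-decrementFirst (suc k) [] = refl
length-decrementFirst (suc k) (x ∷ xs) = cong suc (length-decrementFirst k xs)

sum-incrementFirst : ∀ k xs → k ≤ length xs → sum (incrementFirst k xs) ≡ k + sum xs
sum-incrementFirst zero xs _ = refl
sum-incrementFirst (suc k) (x ∷ xs) (s≤s k≤len) = cong suc (begin
  x + sum (incrementFirst k xs)  ≡⟨ cong (x +_) (sum-incrementFirst k xs k≤len) ⟩
  x + (k + sum xs)  ≡⟨ sym (+-assoc x k _) ⟩
  x + k + sum xs  ≡⟨ cong (_+ sum xs) (+-comm x k) ⟩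
  k + x + sum xs  ≡⟨ +-assoc k x _ ⟩
  k + (x + sum xs)  ∎)
  where open ≡-Reasoning

sum-decrementFirst : ∀ k xs → k ≤ length xs → All (1 ≤_) xs → sum (decrementFirst k xs) + k ≡ sum xs
sum-decrementFirst zero xs _ _ = +-identityʳ _
sum-decrementFirst (suc k) (suc x ∷ xs) (s≤s k≤len) (_ ∷ pos) =
  trans (+-suc _ k) (cong suc (trans (+-assoc x _ k) (cong (x +_) (sum-decrementFirst k xs k≤len pos))))

decrementFirst-incrementFirst : ∀ k xs → decrementFirst k (incrementFirst k xs) ≡ xs
decrementFirst-incrementFirst zero xs = refl
decrementFirst-incrementFirst (suc k) [] = refl
decrementFirst-incrementFirst (suc k) (x ∷ xs) = cong (x ∷_) (decrementFirst-incrementFirst k xs)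

incrementFirst-decrementFirst : ∀ k xs → All (1 ≤_) xs → incrementFirst k (decrementFirst k xs) ≡ xs
incrementFirst-decrementFirst zero xs _ = refl
incrementFirst-decrementFirst (suc k) [] _ = refl
incrementFirst-decrementFirst (suc k) (suc x ∷ xs) (_ ∷ pos) = cong (suc x ∷_) (incrementFirst-decrementFirst k xs pos)

decreasing-incrementFirst : ∀ k xs → StrictlyDecreasing xs → StrictlyDecreasing (incrementFirst k xs)
decreasing-incrementFirst zero xs d = d
decreasing-incrementFirst (suc k) [] d = d
decreasing-incrementFirst (suc zero) (x ∷ []) d = [-]
decreasing-incrementFirst (suc (suc k)) (x ∷ []) d = [-]
decreasing-incrementFirst (suc zero) (x ∷ y ∷ ys) (y<x ∷ d) = m≤n⇒m≤1+n y<x ∷ d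
decreasing-incrementFirst (suc (suc k)) (x ∷ y ∷ ys) (y<x ∷ d) = s≤s y<x ∷ decreasing-incrementFirst (suc k) (y ∷ ys) d

smallest≤smallest-incrementFirst : ∀ k ν → smallest ν ≤ smallest (incrementFirst k ν)
smallest≤smallest-incrementFirst zero ν = ≤-refl
smallest≤smallest-incrementFirst (suc k) [] = ≤-refl
smallest≤smallest-incrementFirst (suc zero) (x ∷ []) = n≤1+n x
smallest≤smallest-incrementFirst (suc (suc k)) (x ∷ []) = n≤1+n x
smallest≤smallest-incrementFirst (suc zero) (x ∷ y ∷ ys) = ≤-refl
smallest≤smallest-incrementFirst (suc (suc k)) (x ∷ y ∷ ys) = smallest≤smallest-incrementFirst (suc k) (y ∷ ys)

smallest-incrementAll : ∀ x xs → smallest (incrementFirst (length (x ∷ xs)) (x ∷ xs)) ≡ suc (smallest (x ∷ xs))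
smallest-incrementAll x [] = refl
smallest-incrementAll x (y ∷ ys) = smallest-incrementAll y ys

smallest-decrementFirst : ∀ k xs → k < length xs → smallest (decrementFirst k xs) ≡ smallest xs
smallest-decrementFirst zero xs _ = refl
smallest-decrementFirst (suc k) (x ∷ []) (s≤s ())
smallest-decrementFirst (suc zero) (x ∷ y ∷ ys) _ = refl
smallest-decrementFirst (suc (suc k)) (x ∷ y ∷ ys) (s≤s k<len) = smallest-decrementFirst (suc k) (y ∷ ys) k<len

smallest-decrementAll : ∀ xs → smallest (decrementFirst (length xs) xs) ≡ pred (smallest xs)
smallest-decrementAll [] = refl
smallest-decrementAll (x ∷ []) = refl
smallest-decrementAll (x ∷ y ∷ ys) = smallest-decrementAll (y ∷ ys)

decreasing-decrementTopRun : ∀ xs → StrictlyDecreasing xs → 1 ≤ smallest xs →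
  StrictlyDecreasing (decrementFirst (topRun xs) xs)
decreasing-decrementTopRun [] _ _ = []
decreasing-decrementTopRun (x ∷ []) _ _ = [-]
decreasing-decrementTopRun (x ∷ y ∷ ys) (y<x ∷ d) 1≤s with x ≟ suc y
decreasing-decrementTopRun (suc x ∷ y ∷ ys) (s≤s y≤x ∷ d) 1≤s | no 1+x≢1+y =
  ≤∧≢⇒< y≤x (λ y≡x → 1+x≢1+y (cong suc (sym y≡x))) ∷ d
decreasing-decrementTopRun (.(suc y) ∷ y ∷ ys) (_ ∷ d) 1≤s | yes refl
  with topRun (y ∷ ys) | topRun-positive y ys | decreasing-decrementTopRun (y ∷ ys) d 1≤s
... | suc r | _ | ih = ≤-reflexive (suc-pred y {{>-nonZero (≤-trans 1≤s (decreasing-smallest≤head d))}}) ∷ ih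

spreadSmallest : List ℕ → List ℕ
spreadSmallest μ = incrementFirst (smallest μ) (dropLast μ)

gatherTopRun : List ℕ → List ℕ
gatherTopRun μ = decrementFirst (topRun μ) μ ∷ʳ topRun μ

-- Franklin's conditions, arranged to be exclusive and to fail together only on the staircases.
SpreadApplies : List ℕ → Set
SpreadApplies μ = smallest μ ≤ topRun μ × smallest μ < length μ

GatherApplies : List ℕ → Set
GatherApplies μ = topRun μ < smallest μ × (topRun μ < length μ ⊎ 2 + length μ ≤ smallest μ)

spreadApplies? : Decidable SpreadApplies
spreadApplies? μ = (smallest μ ≤? topRun μ) ×-dec (smallest μ <? length μ)

gatherApplies? : Decidable GatherApplies
gatherApplies? μ = (topRun μ <? smallest μ) ×-dec ((topRun μ <? length μ) ⊎-dec (2 + length μ ≤? smallest μ))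

gather⇒¬spread : ∀ {μ} → GatherApplies μ → ¬ SpreadApplies μ
gather⇒¬spread (r<s , _) (s≤r , _) = <⇒≱ r<s s≤r

incrementFirst-top3 : ∀ k a r → 3 ≤ k →
  Σ (List ℕ) λ t → incrementFirst k (suc (suc a) ∷ suc a ∷ a ∷ r) ≡ suc (suc (suc a)) ∷ suc (suc a) ∷ suc a ∷ t
incrementFirst-top3 (suc (suc (suc k))) a r _ = incrementFirst k r , refl
incrementFirst-top3 (suc zero) a r (s≤s ())
incrementFirst-top3 (suc (suc zero)) a r (s≤s (s≤s ()))

decrementFirst-top3 : ∀ k a r → 3 ≤ k →
  Σ (List ℕ) λ t → decrementFirst k (suc (suc (suc a)) ∷ suc (suc a) ∷ suc a ∷ r) ≡ suc (suc a) ∷ suc a ∷ a ∷ t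
decrementFirst-top3 (suc (suc (suc k))) a r _ = decrementFirst k r , refl
decrementFirst-top3 (suc zero) a r (s≤s ())
decrementFirst-top3 (suc (suc zero)) a r (s≤s (s≤s ()))

sum-spreadSmallest : ∀ x xs → smallest (x ∷ xs) ≤ length (dropLast (x ∷ xs)) →
  sum (spreadSmallest (x ∷ xs)) ≡ sum (x ∷ xs)
sum-spreadSmallest x xs s≤len = begin
  sum (incrementFirst s (dropLast (x ∷ xs)))  ≡⟨ sum-incrementFirst s (dropLast (x ∷ xs)) s≤len ⟩
  s + sum (dropLast (x ∷ xs))                 ≡⟨ +-comm s _ ⟩
  sum (dropLast (x ∷ xs)) + s                 ≡⟨ sum-dropLast x xs ⟩
  sum (x ∷ xs)                                ∎
  where
  open ≡-Reasoning
  s : ℕ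
  s = smallest (x ∷ xs)

gatherTopRun-spreadSmallest : ∀ x xs → topRun (spreadSmallest (x ∷ xs)) ≡ smallest (x ∷ xs) →
  gatherTopRun (spreadSmallest (x ∷ xs)) ≡ x ∷ xs
gatherTopRun-spreadSmallest x xs r≡s = begin
  decrementFirst (topRun (spreadSmallest (x ∷ xs))) (spreadSmallest (x ∷ xs)) ∷ʳ topRun (spreadSmallest (x ∷ xs))
    ≡⟨ cong (λ r → decrementFirst r (spreadSmallest (x ∷ xs)) ∷ʳ r) r≡s ⟩
  decrementFirst s (incrementFirst s (dropLast (x ∷ xs))) ∷ʳ s
    ≡⟨ cong (_∷ʳ s) (decrementFirst-incrementFirst s (dropLast (x ∷ xs))) ⟩
  dropLast (x ∷ xs) ∷ʳ s
    ≡⟨ dropLast-∷ʳ-smallest x xs ⟩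
  x ∷ xs ∎
  where
  open ≡-Reasoning
  s : ℕ
  s = smallest (x ∷ xs)

spreadSmallest-gatherCondition : ∀ x y ys → StrictlyDecreasing (x ∷ y ∷ ys) →
  smallest (x ∷ y ∷ ys) ≤ length (dropLast (x ∷ y ∷ ys)) →
  smallest (x ∷ y ∷ ys) < length (spreadSmallest (x ∷ y ∷ ys)) ⊎
  2 + length (spreadSmallest (x ∷ y ∷ ys)) ≤ smallest (spreadSmallest (x ∷ y ∷ ys))
spreadSmallest-gatherCondition x y ys d s≤len with smallest (x ∷ y ∷ ys) <? length ν
  where
  ν : List ℕ
  ν = dropLast (x ∷ y ∷ ys)
... | yes s<len =
  inj₁ (subst (smallest (x ∷ y ∷ ys) <_) (sym (length-incrementFirst (smallest (x ∷ y ∷ ys)) (dropLast (x ∷ y ∷ ys)))) s<len)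
... | no s≮len = inj₂ (subst (2 + length (spreadSmallest (x ∷ y ∷ ys)) ≤_) (sym smallest-spread)
        (s≤s (subst (λ l → suc l ≤ smallest ν) (trans s≡len (sym (length-incrementFirst s ν)))
                (smallest<smallest-dropLast x y ys d))))
  where
  s : ℕ
  s = smallest (x ∷ y ∷ ys)
  ν : List ℕ
  ν = dropLast (x ∷ y ∷ ys)
  s≡len : s ≡ length ν
  s≡len = ≤-antisym s≤len (≮⇒≥ s≮len)
  smallest-spread : smallest (spreadSmallest (x ∷ y ∷ ys)) ≡ suc (smallest ν)
  smallest-spread = trans (cong (λ k → smallest (incrementFirst k ν)) s≡len) (smallest-incrementAll x (dropLast (y ∷ ys)))

spreadSmallest-properties : ∀ {m μ} → Top3Distinct 3 m μ → SpreadApplies μ →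
  Top3Distinct 3 m (spreadSmallest μ) × GatherApplies (spreadSmallest μ) ×
  largest (spreadSmallest μ) ≡ suc (largest μ) × gatherTopRun (spreadSmallest μ) ≡ μ
spreadSmallest-properties (_ , (a , [] , refl) , 3≤s , _) (_ , s<3) = ⊥-elim (<⇒≱ s<3 3≤s)
spreadSmallest-properties {m} {μ} (d , (a , c ∷ cs , refl) , 3≤s , μ-sum) (s≤r , s<len) =
  (decreasing-incrementFirst s ν (decreasing-dropLast μ d) , (suc a , spread-top3) ,
     ≤-trans 3≤s (<⇒≤ s<smallest) , trans (sum-spreadSmallest (suc (suc a)) (suc a ∷ a ∷ c ∷ cs) s≤len-ν) μ-sum) ,
  (subst (_< smallest (spreadSmallest μ)) (sym spread-topRun) s<smallest ,
   subst (λ r → r < length (spreadSmallest μ) ⊎ 2 + length (spreadSmallest μ) ≤ smallest (spreadSmallest μ)) (sym spread-topRun)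
     (spreadSmallest-gatherCondition (suc (suc a)) (suc a) (a ∷ c ∷ cs) d s≤len-ν)) ,
  cong largest (proj₂ spread-top3) , gatherTopRun-spreadSmallest (suc (suc a)) (suc a ∷ a ∷ c ∷ cs) spread-topRun
  where
  s : ℕ
  s = smallest μ
  ν : List ℕ
  ν = dropLast μ
  s≤len-ν : s ≤ length ν
  s≤len-ν = ≤-pred (subst (suc s ≤_) (sym (length-dropLast (suc (suc a)) (suc a ∷ a ∷ c ∷ cs))) s<len)
  spread-top3 : Σ (List ℕ) λ t → spreadSmallest μ ≡ suc (suc (suc a)) ∷ suc (suc a) ∷ suc a ∷ t
  spread-top3 = incrementFirst-top3 s a (dropLast (c ∷ cs)) 3≤s
  s<smallest : s < smallest (spreadSmallest μ)
  s<smallest = ≤-trans (smallest<smallest-dropLast _ _ _ d) (smallest≤smallest-incrementFirst s ν)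
  spread-topRun : topRun (spreadSmallest μ) ≡ s
  spread-topRun = topRun-incrementFirst s ν (decreasing-dropLast μ d) (≤-trans (s≤s z≤n) 3≤s) s≤len-ν
    (topRun-dropLast s μ s≤r s<len)

smallest-gatherTopRun : ∀ μ → smallest (gatherTopRun μ) ≡ topRun μ
smallest-gatherTopRun μ = smallest-∷ʳ (decrementFirst (topRun μ) μ) (topRun μ)

length-gatherTopRun : ∀ μ → length (gatherTopRun μ) ≡ suc (length μ)
length-gatherTopRun μ =
  trans (length-++ (decrementFirst (topRun μ) μ)) (trans (cong (_+ 1) (length-decrementFirst (topRun μ) μ)) (+-comm _ 1))

sum-gatherTopRun : ∀ μ → All (1 ≤_) μ → sum (gatherTopRun μ) ≡ sum μ
sum-gatherTopRun μ pos = trans (sum-++ (decrementFirst ρ μ) (ρ ∷ []))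
  (trans (cong (sum (decrementFirst ρ μ) +_) (+-identityʳ ρ)) (sum-decrementFirst ρ μ (topRun≤length μ) pos))
  where
  ρ : ℕ
  ρ = topRun μ

spreadSmallest-gatherTopRun : ∀ μ → All (1 ≤_) μ → spreadSmallest (gatherTopRun μ) ≡ μ
spreadSmallest-gatherTopRun μ pos =
  trans (cong₂ incrementFirst (smallest-gatherTopRun μ) (dropLast-∷ʳ (decrementFirst (topRun μ) μ) (topRun μ)))
        (incrementFirst-decrementFirst (topRun μ) μ pos)

topRun<smallest-decrementTopRun : ∀ μ → GatherApplies μ → topRun μ < smallest (decrementFirst (topRun μ) μ)
topRun<smallest-decrementTopRun μ (r<s , gather-possible) with topRun μ <? length μ
... | yes r<len = subst (topRun μ <_) (sym (smallest-decrementFirst (topRun μ) μ r<len)) r<s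
... | no r≮len = case gather-possible
  where
  r≡len : topRun μ ≡ length μ
  r≡len = ≤-antisym (topRun≤length μ) (≮⇒≥ r≮len)
  case : topRun μ < length μ ⊎ 2 + length μ ≤ smallest μ → topRun μ < smallest (decrementFirst (topRun μ) μ)
  case (inj₁ r<len) = ⊥-elim (r≮len r<len)
  case (inj₂ 2+len≤s) =
    subst (topRun μ <_) (sym (trans (cong (λ k → smallest (decrementFirst k μ)) r≡len) (smallest-decrementAll μ)))
      (subst (_< pred (smallest μ)) (sym r≡len) (<⇒≤pred 2+len≤s))

gatherTopRun-properties : ∀ {m μ} → Top3Distinct 3 m μ → GatherApplies μ →
  Top3Distinct 3 m (gatherTopRun μ) × SpreadApplies (gatherTopRun μ) ×
  suc (largest (gatherTopRun μ)) ≡ largest μ × spreadSmallest (gatherTopRun μ) ≡ μ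
gatherTopRun-properties (d , (zero , r , refl) , 3≤s , _) _ =
  ⊥-elim (<⇒≱ 3≤s (≤-trans (decreasing-smallest≤head {0} {r} (Linked.tail (Linked.tail d))) z≤n))
gatherTopRun-properties {m} {μ} (d , (suc a , r , refl) , 3≤s , μ-sum) gather =
  (gather-decreasing , (a , proj₁ gather-top3 ∷ʳ ρ , cong (_∷ʳ ρ) (proj₂ gather-top3)) ,
     subst (3 ≤_) (sym (smallest-gatherTopRun μ)) 3≤ρ , trans (sum-gatherTopRun μ μ-positive) μ-sum) ,
  (subst (_≤ topRun (gatherTopRun μ)) (sym (smallest-gatherTopRun μ))
     (≤-trans (topRun-decrementFirst ρ μ ≤-refl μ-positive) (topRun-++ (decrementFirst ρ μ) (ρ ∷ []))) ,
   subst₂ _<_ (sym (smallest-gatherTopRun μ)) (sym (length-gatherTopRun μ)) (s≤s (topRun≤length μ))) ,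
  cong (λ ν → suc (largest (ν ∷ʳ ρ))) (proj₂ gather-top3) ,
  spreadSmallest-gatherTopRun μ μ-positive
  where
  ρ : ℕ
  ρ = topRun μ
  μ-positive : All (1 ≤_) μ
  μ-positive = All.map (≤-trans (≤-trans (s≤s z≤n) 3≤s)) (decreasing-all≥smallest μ d)
  3≤ρ : 3 ≤ ρ
  3≤ρ = topRun-top3 (suc a) r
  gather-top3 : Σ (List ℕ) λ t → decrementFirst ρ μ ≡ suc (suc a) ∷ suc a ∷ a ∷ t
  gather-top3 = decrementFirst-top3 ρ a r 3≤ρ
  gather-decreasing : StrictlyDecreasing (gatherTopRun μ)
  gather-decreasing = decreasing-∷ʳ (decrementFirst ρ μ) ρ
    (decreasing-decrementTopRun μ d (≤-trans (s≤s z≤n) 3≤s))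
    (subst (1 ≤_) (sym (cong length (proj₂ gather-top3))) (s≤s z≤n)) (topRun<smallest-decrementTopRun μ gather)

%2-+2 : ∀ h → (2 + h) % 2 ≡ h % 2
%2-+2 h = trans (cong (_% 2) (+-comm 2 h)) ([m+n]%n≡m%n h 2)

suc-%2 : ∀ h → suc h % 2 ≡ 1 ∸ h % 2
suc-%2 zero = refl
suc-%2 (suc zero) = refl
suc-%2 (suc (suc h)) = trans (%2-+2 (suc h)) (trans (suc-%2 h) (cong (1 ∸_) (sym (%2-+2 h))))

%2-pred : ∀ h {p} → p ≤ 1 → suc h % 2 ≡ 1 ∸ p → h % 2 ≡ p
%2-pred h {p} p≤1 e = begin
  h % 2              ≡⟨ sym (m∸[m∸n]≡n (≤-pred (m%n<n h 2))) ⟩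
  1 ∸ (1 ∸ h % 2)    ≡⟨ cong (1 ∸_) (sym (suc-%2 h)) ⟩
  1 ∸ suc h % 2      ≡⟨ cong (1 ∸_) e ⟩
  1 ∸ (1 ∸ p)        ≡⟨ m∸[m∸n]≡n p≤1 ⟩
  p                  ∎
  where open ≡-Reasoning

franklin-bijection : ∀ m p {c} → p ≤ 1 → HasCount (Top3DistinctParity 3 m p ∩ SpreadApplies) c →
  HasCount ((Top3DistinctParity 3 m (1 ∸ p) ∩ ∁ SpreadApplies) ∩ GatherApplies) c
franklin-bijection m p p≤1 h = hasCount-bijection h spreadSmallest gatherTopRun
  (λ {μ} ((top3 , parity) , spread) → let (top3′ , gather , largest≡ , _) = spreadSmallest-properties top3 spread in
     ((top3′ , trans (cong (_% 2) largest≡) (trans (suc-%2 (largest μ)) (cong (1 ∸_) parity))) ,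
      gather⇒¬spread {spreadSmallest μ} gather) , gather)
  (λ {ν} (((top3 , parity) , _) , gather) → let (top3′ , spread , largest≡ , _) = gatherTopRun-properties top3 gather in
     (top3′ , %2-pred (largest (gatherTopRun ν)) p≤1 (trans (cong (_% 2) largest≡) parity)) , spread)
  (λ ((top3 , _) , spread) → proj₂ (proj₂ (proj₂ (spreadSmallest-properties top3 spread))))
  (λ (((top3 , _) , _) , gather) → proj₂ (proj₂ (proj₂ (gatherTopRun-properties top3 gather))))

-- Pentagonal numbers

PentagonalPlus PentagonalMinus Pentagonal : ℕ → Set
PentagonalPlus m = Σ ℕ λ k → 3 ≤ k × 2 * m ≡ 3 * (k * k) + k
PentagonalMinus m = Σ ℕ λ k → 3 ≤ k × 2 * m + k ≡ 3 * (k * k)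
Pentagonal m = PentagonalPlus m ⊎ PentagonalMinus m

InPentagonalRange : ℕ → ℕ → Set
InPentagonalRange k x = 3 * (k * k) ≤ x + k × x ≤ 3 * (k * k) + k

plus-range : ∀ {k x} → x ≡ 3 * (k * k) + k → InPentagonalRange k x
plus-range {k} refl = ≤-trans (m≤m+n _ k) (m≤m+n _ k) , ≤-refl

minus-range : ∀ {k x} → x + k ≡ 3 * (k * k) → InPentagonalRange k x
minus-range {k} {x} e = ≤-reflexive (sym e) , ≤-trans (m≤m+n x k) (≤-trans (≤-reflexive e) (m≤m+n _ k))

pentagonal-range : ∀ {m} → Pentagonal m → Σ ℕ λ k → 3 ≤ k × InPentagonalRange k (2 * m)
pentagonal-range (inj₁ (k , 3≤k , e)) = k , 3≤k , plus-range e
pentagonal-range (inj₂ (k , 3≤k , e)) = k , 3≤k , minus-range e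

square-gap : ∀ {k k′} → k < k′ → 3 * (k * k) + k + (4 * k + 2) + k′ ≤ 3 * (k′ * k′)
square-gap {k} {suc k′} (s≤s k≤k′) with m≤n⇒∃[o]m+o≡n k≤k′
... | d , refl = subst (3 * (k * k) + k + (4 * k + 2) + suc (k + d) ≤_) (expand k d) (m≤m+n _ _)
  where
  expand : ∀ k d → 3 * (k * k) + k + (4 * k + 2) + suc (k + d) + (6 * k * d + 3 * d * d + 5 * d)
                   ≡ 3 * (suc (k + d) * suc (k + d))
  expand = solve-∀

-- Consecutive ranges [3k² − k, 3k² + k] are more than 4 apart.
range-index-≡ : ∀ {k k′ x y} → 1 ≤ k → InPentagonalRange k x → InPentagonalRange k′ y →
  x ≤ y → y ≤ 4 + x → k ≡ k′
range-index-≡ {k} {k′} {x} {y} 1≤k (x≥ , x≤) (y≥ , y≤) x≤y y≤4+x with <-cmp k k′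
... | tri≈ _ k≡k′ _ = k≡k′
... | tri< k<k′ _ _ = ⊥-elim (<⇒≱ too-small (+-cancelʳ-≤ k′ _ _ (≤-trans (square-gap k<k′) y≥)))
  where
  too-small : y < 3 * (k * k) + k + (4 * k + 2)
  too-small = begin-strict
    y                             ≤⟨ y≤4+x ⟩
    4 + x                         ≤⟨ +-monoʳ-≤ 4 x≤ ⟩
    4 + (3 * (k * k) + k)         ≡⟨ +-comm 4 _ ⟩
    3 * (k * k) + k + 4
      <⟨ +-monoʳ-< (3 * (k * k) + k) (≤-trans (s≤s (n≤1+n 4)) (+-monoˡ-≤ 2 (*-monoʳ-≤ 4 1≤k))) ⟩
    3 * (k * k) + k + (4 * k + 2) ∎
    where open ≤-Reasoning
... | tri> _ _ k′<k = ⊥-elim (<⇒≱ (m<m+n (3 * (k′ * k′) + k′) (subst (0 <_) (+-comm 2 (4 * k′)) (s≤s z≤n)))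
                          (≤-trans (+-cancelʳ-≤ k _ _ (≤-trans (square-gap k′<k) x≥)) (≤-trans x≤y y≤)))

twice-2+ : ∀ m → 2 * (2 + m) ≡ 4 + 2 * m
twice-2+ m = *-distribˡ-+ 2 2 m

4+x≢x : ∀ x → 4 + x ≢ x
4+x≢x x 4+x≡x = m≢1+n+m x (sym 4+x≡x)

gap-index : ∀ {m k k′} → 3 ≤ k → InPentagonalRange k (2 * m) → InPentagonalRange k′ (2 * (2 + m)) → k ≡ k′
gap-index {m} {k′ = k′} 3≤k range range′ =
  range-index-≡ (≤-trans (s≤s z≤n) 3≤k) range (subst (InPentagonalRange k′) (twice-2+ m) range′) (m≤n+m (2 * m) 4) ≤-refl

pentagonal-gap : ∀ {m} → Pentagonal m → Pentagonal (2 + m) → ⊥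
pentagonal-gap {m} (inj₁ (k , 3≤k , e)) (inj₁ (k′ , _ , e′)) with gap-index 3≤k (plus-range {k} e) (plus-range {k′} e′)
... | refl = 4+x≢x (2 * m) (trans (sym (twice-2+ m)) (trans e′ (sym e)))
pentagonal-gap {m} (inj₂ (k , 3≤k , e)) (inj₂ (k′ , _ , e′)) with gap-index 3≤k (minus-range {k} e) (minus-range {k′} e′)
... | refl = 4+x≢x (2 * m) (+-cancelʳ-≡ k _ _ (trans (cong (_+ k) (sym (twice-2+ m))) (trans e′ (sym e))))
pentagonal-gap {m} (inj₁ (k , 3≤k , e)) (inj₂ (k′ , _ , e′)) with gap-index 3≤k (plus-range {k} e) (minus-range {k′} e′)
... | refl = m+1+n≢m (3 * (k * k)) (begin
  3 * (k * k) + (4 + k + k)    ≡⟨ regroup (3 * (k * k)) k ⟩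
  4 + (3 * (k * k) + k) + k    ≡⟨ cong (λ v → 4 + v + k) (sym e) ⟩
  4 + 2 * m + k                ≡⟨ cong (_+ k) (sym (twice-2+ m)) ⟩
  2 * (2 + m) + k              ≡⟨ e′ ⟩
  3 * (k * k)                  ∎)
  where
  open ≡-Reasoning
  regroup : ∀ c k → c + (4 + k + k) ≡ 4 + (c + k) + k
  regroup = solve-∀
pentagonal-gap {m} (inj₂ (k , 3≤k , e)) (inj₁ (k′ , _ , e′)) with gap-index 3≤k (minus-range {k} e) (plus-range {k′} e′)
... | refl = <⇒≢ (≤-trans (n≤1+n 5) (+-mono-≤ 3≤k 3≤k)) (sym (+-cancelʳ-≡ (2 * m) _ _ (begin
  k + k + 2 * m        ≡⟨ regroup (2 * m) k ⟩
  2 * m + k + k        ≡⟨ cong (_+ k) e ⟩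
  3 * (k * k) + k      ≡⟨ sym e′ ⟩
  2 * (2 + m)          ≡⟨ twice-2+ m ⟩
  4 + 2 * m            ∎)))
  where
  open ≡-Reasoning
  regroup : ∀ v k → k + k + v ≡ v + k + k
  regroup = solve-∀

plus-minus-disjoint : ∀ {m} → PentagonalPlus m → PentagonalMinus m → ⊥
plus-minus-disjoint {m} (k , 3≤k , e) (k′ , _ , e′)
  with range-index-≡ (≤-trans (s≤s z≤n) 3≤k) (plus-range {k} e) (minus-range {k′} e′) ≤-refl (m≤n+m (2 * m) 4)
... | refl = <⇒≢ (≤-trans (s≤s z≤n) (≤-trans 3≤k (m≤m+n k k))) (sym (+-cancelˡ-≡ (2 * m) (k + k) 0 (begin
  2 * m + (k + k)  ≡⟨ sym (+-assoc (2 * m) k k) ⟩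
  2 * m + k + k    ≡⟨ cong (_+ k) e′ ⟩
  3 * (k * k) + k  ≡⟨ sym e ⟩
  2 * m            ≡⟨ sym (+-identityʳ (2 * m)) ⟩
  2 * m + 0        ∎)))
  where open ≡-Reasoning

pentagonal-≥12 : ∀ {m} → Pentagonal m → 12 ≤ m
pentagonal-≥12 {m} p with pentagonal-range {m} p
... | k , 3≤k , (lower , _) = *-cancelˡ-≤ {12} {m} 2 (+-cancelʳ-≤ k 24 (2 * m) (begin
  24 + k           ≤⟨ +-monoˡ-≤ k (*-monoʳ-≤ 8 3≤k) ⟩
  8 * k + k        ≡⟨ regroup k ⟩
  3 * (3 * k)      ≤⟨ *-monoʳ-≤ 3 (*-monoˡ-≤ k 3≤k) ⟩
  3 * (k * k)      ≤⟨ lower ⟩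
  2 * m + k        ∎))
  where
  open ≤-Reasoning
  regroup : ∀ k → 8 * k + k ≡ 3 * (3 * k)
  regroup = solve-∀

-- Staircases: the fixed points of Franklin's involution

staircase : ℕ → ℕ → List ℕ
staircase b zero = []
staircase b (suc k) = k + b ∷ staircase b k

length-staircase : ∀ b k → length (staircase b k) ≡ k
length-staircase b zero = refl
length-staircase b (suc k) = cong suc (length-staircase b k)

smallest-staircase : ∀ b k → smallest (staircase b (suc k)) ≡ b
smallest-staircase b zero = refl
smallest-staircase b (suc k) = smallest-staircase b k

decreasing-staircase : ∀ b k → StrictlyDecreasing (staircase b k)
decreasing-staircase b zero = []
decreasing-staircase b (suc zero) = [-]
decreasing-staircase b (suc (suc k)) = n<1+n (k + b) ∷ decreasing-staircase b (suc k)

topRun-staircase : ∀ b k → topRun (staircase b k) ≡ k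
topRun-staircase b zero = refl
topRun-staircase b (suc zero) = refl
topRun-staircase b (suc (suc k)) = trans (topRun-consecutive (staircase b k) refl) (cong suc (topRun-staircase b (suc k)))

sum-staircase : ∀ b k → 2 * sum (staircase b k) + k ≡ k * k + 2 * k * b
sum-staircase b zero = refl
sum-staircase b (suc k) = begin
  2 * (k + b + sum (staircase b k)) + suc k   ≡⟨ regroup₁ k b (sum (staircase b k)) ⟩
  (2 * sum (staircase b k) + k) + (2 * k + 2 * b + 1)   ≡⟨ cong (_+ (2 * k + 2 * b + 1)) (sum-staircase b k) ⟩
  (k * k + 2 * k * b) + (2 * k + 2 * b + 1)   ≡⟨ regroup₂ k b ⟩
  suc k * suc k + 2 * suc k * b   ∎
  where
  open ≡-Reasoning
  regroup₁ : ∀ k b S → 2 * (k + b + S) + suc k ≡ (2 * S + k) + (2 * k + 2 * b + 1)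
  regroup₁ = solve-∀
  regroup₂ : ∀ k b → (k * k + 2 * k * b) + (2 * k + 2 * b + 1) ≡ suc k * suc k + 2 * suc k * b
  regroup₂ = solve-∀

sum-staircase⁺ : ∀ k → 2 * sum (staircase (suc k) k) ≡ 3 * (k * k) + k
sum-staircase⁺ k = +-cancelʳ-≡ k _ _ (trans (sum-staircase (suc k) k) (regroup k))
  where
  regroup : ∀ k → k * k + 2 * k * suc k ≡ 3 * (k * k) + k + k
  regroup = solve-∀

sum-staircase⁻ : ∀ k → 2 * sum (staircase k k) + k ≡ 3 * (k * k)
sum-staircase⁻ k = trans (sum-staircase k k) (regroup k)
  where
  regroup : ∀ k → k * k + 2 * k * k ≡ 3 * (k * k)
  regroup = solve-∀

full-topRun⇒staircase : ∀ x xs → topRun (x ∷ xs) ≡ length (x ∷ xs) →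
  x ∷ xs ≡ staircase (smallest (x ∷ xs)) (length (x ∷ xs))
full-topRun⇒staircase x [] _ = refl
full-topRun⇒staircase x (y ∷ ys) r≡len with topRun-cases x y ys
... | inj₂ (_ , r≡1) = ⊥-elim (1+n≢0 (suc-injective (trans (sym r≡len) r≡1)))
... | inj₁ (x≡1+y , r≡) = cong₂ _∷_ (trans x≡1+y (cong suc (cong largest ih))) ih
  where
  ih : y ∷ ys ≡ staircase (smallest (y ∷ ys)) (length (y ∷ ys))
  ih = full-topRun⇒staircase y ys (suc-injective (trans (sym r≡) r≡len))

staircase-top3 : ∀ b j → TopThreeConsecutive (staircase b (3 + j))
staircase-top3 b j = j + b , staircase b j , refl

largest-staircase-even : ∀ j → largest (staircase (2 + j) (suc j)) % 2 ≡ 0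
largest-staircase-even j = trans (cong (_% 2) (twice j)) (m*n%n≡0 (suc j) 2)
  where
  twice : ∀ j → j + (2 + j) ≡ suc j * 2
  twice = solve-∀

largest-staircase-odd : ∀ j → largest (staircase (suc j) (suc j)) % 2 ≡ 1
largest-staircase-odd j = trans (cong (_% 2) (twice j)) ([m+kn]%n≡m%n 1 j 2)
  where
  twice : ∀ j → j + suc j ≡ 1 + j * 2
  twice = solve-∀

FranklinFixed : ℕ → ℕ → List ℕ → Set
FranklinFixed m p = (Top3DistinctParity 3 m p ∩ ∁ SpreadApplies) ∩ ∁ GatherApplies

fixed? : ∀ m p → Decidable (FranklinFixed m p)
fixed? m p = (top3DistinctParity? 3 m p ∩? ∁? spreadApplies?) ∩? ∁? gatherApplies?

fixedCount : ℕ → ℕ → ℕ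
fixedCount m p = count (fixed? m p) m

hasCount-fixed : ∀ m p → HasCount (FranklinFixed m p) (fixedCount m p)
hasCount-fixed m p = hasCount-top3Distinct (fixed? m p) 3 m (s≤s z≤n) λ f → proj₁ (proj₁ (proj₁ f))

fixed-sum : ∀ {m p μ} → FranklinFixed m p μ → sum μ ≡ m
fixed-sum ((((_ , _ , _ , μ-sum) , _) , _) , _) = μ-sum

fixed-shape : ∀ {μ} → ¬ SpreadApplies μ → ¬ GatherApplies μ →
  topRun μ ≡ length μ × (smallest μ ≡ length μ ⊎ smallest μ ≡ suc (length μ))
fixed-shape {μ} ¬spread ¬gather with smallest μ ≤? topRun μ
... | yes s≤r = r≡len , inj₁ (≤-antisym (≤-trans s≤r (topRun≤length μ)) len≤s)
  where
  len≤s : length μ ≤ smallest μ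
  len≤s = ≮⇒≥ (λ s<len → ¬spread (s≤r , s<len))
  r≡len : topRun μ ≡ length μ
  r≡len = ≤-antisym (topRun≤length μ) (≤-trans len≤s s≤r)
... | no s≰r = r≡len , inj₂ (≤-antisym s≤1+len (subst (_< smallest μ) r≡len r<s))
  where
  r<s : topRun μ < smallest μ
  r<s = ≰⇒> s≰r
  r≡len : topRun μ ≡ length μ
  r≡len = ≤-antisym (topRun≤length μ) (≮⇒≥ (λ r<len → ¬gather (r<s , inj₁ r<len)))
  s≤1+len : smallest μ ≤ suc (length μ)
  s≤1+len = ≤-pred (≰⇒> (λ 2+len≤s → ¬gather (r<s , inj₂ 2+len≤s)))

fixed⇒staircase : ∀ {m p μ} → FranklinFixed m p μ → Σ ℕ λ k → 3 ≤ k ×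
  ((μ ≡ staircase (suc k) k × p ≡ 0) ⊎ (μ ≡ staircase k k × p ≡ 1))
fixed⇒staircase {p = p} {μ = μ} ((((d , (a , r , refl) , _ , _) , parity) , ¬spread) , ¬gather)
  with fixed-shape {μ} ¬spread ¬gather
... | r≡len , s≡ = length μ , s≤s (s≤s (s≤s z≤n)) , shape s≡
  where
  μ≡ : μ ≡ staircase (smallest μ) (length μ)
  μ≡ = full-topRun⇒staircase (suc (suc a)) (suc a ∷ a ∷ r) r≡len
  shape : smallest μ ≡ length μ ⊎ smallest μ ≡ suc (length μ) →
    (μ ≡ staircase (suc (length μ)) (length μ) × p ≡ 0) ⊎ (μ ≡ staircase (length μ) (length μ) × p ≡ 1)
  shape (inj₁ s≡len) =
    inj₂ (μ≡′ , trans (sym parity) (trans (cong (λ ν → largest ν % 2) μ≡′) (largest-staircase-odd (2 + length r))))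
    where
    μ≡′ : μ ≡ staircase (length μ) (length μ)
    μ≡′ = trans μ≡ (cong (λ b → staircase b (length μ)) s≡len)
  shape (inj₂ s≡1+len) =
    inj₁ (μ≡′ , trans (sym parity) (trans (cong (λ ν → largest ν % 2) μ≡′) (largest-staircase-even (2 + length r))))
    where
    μ≡′ : μ ≡ staircase (suc (length μ)) (length μ)
    μ≡′ = trans μ≡ (cong (λ b → staircase b (length μ)) s≡1+len)

fixed⁺-staircase : ∀ {m μ} → FranklinFixed m 0 μ →
  Σ ℕ λ k → (3 ≤ k × 2 * m ≡ 3 * (k * k) + k) × μ ≡ staircase (suc k) k
fixed⁺-staircase f with fixed⇒staircase f
... | k , 3≤k , inj₁ (refl , _) = k , (3≤k , trans (cong (2 *_) (sym (fixed-sum f))) (sum-staircase⁺ k)) , refl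

fixed⁻-staircase : ∀ {m μ} → FranklinFixed m 1 μ →
  Σ ℕ λ k → (3 ≤ k × 2 * m + k ≡ 3 * (k * k)) × μ ≡ staircase k k
fixed⁻-staircase f with fixed⇒staircase f
... | k , 3≤k , inj₂ (refl , _) = k , (3≤k , trans (cong (λ s → 2 * s + k) (sym (fixed-sum f))) (sum-staircase⁻ k)) , refl

staircase⁺-fixed : ∀ {m k} → 3 ≤ k → 2 * m ≡ 3 * (k * k) + k → FranklinFixed m 0 (staircase (suc k) k)
staircase⁺-fixed {k = suc zero} (s≤s ()) _
staircase⁺-fixed {k = suc (suc zero)} (s≤s (s≤s ())) _
staircase⁺-fixed {m} {k@(suc (suc (suc j)))} _ e =
  (((decreasing-staircase (suc k) k , staircase-top3 (suc k) j ,
     subst (3 ≤_) (sym (smallest-staircase (suc k) (2 + j))) (s≤s (s≤s (s≤s z≤n))) ,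
     *-cancelˡ-≡ _ _ 2 (trans (sum-staircase⁺ k) (sym e))) ,
    largest-staircase-even (2 + j)) ,
   (λ (_ , s<len) →
      1+n≰n (≤-trans (subst₂ _<_ (smallest-staircase (suc k) (2 + j)) (length-staircase (suc k) k) s<len) (n≤1+n k)))) ,
  (λ { (_ , inj₁ r<len) → <-irrefl (trans (topRun-staircase (suc k) k) (sym (length-staircase (suc k) k))) r<len
     ; (_ , inj₂ 2+len≤s) →
         1+n≰n (subst₂ (λ len s → 2 + len ≤ s) (length-staircase (suc k) k) (smallest-staircase (suc k) (2 + j)) 2+len≤s) })

staircase⁻-fixed : ∀ {m k} → 3 ≤ k → 2 * m + k ≡ 3 * (k * k) → FranklinFixed m 1 (staircase k k)
staircase⁻-fixed {k = suc zero} (s≤s ()) _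
staircase⁻-fixed {k = suc (suc zero)} (s≤s (s≤s ())) _
staircase⁻-fixed {m} {k@(suc (suc (suc j)))} _ e =
  (((decreasing-staircase k k , staircase-top3 k j ,
     subst (3 ≤_) (sym (smallest-staircase k (2 + j))) (s≤s (s≤s (s≤s z≤n))) ,
     *-cancelˡ-≡ _ _ 2 (+-cancelʳ-≡ k _ _ (trans (sum-staircase⁻ k) (sym e)))) ,
    largest-staircase-odd (2 + j)) ,
   (λ (_ , s<len) → <-irrefl (trans (smallest-staircase k (2 + j)) (sym (length-staircase k k))) s<len)) ,
  (λ (r<s , _) → <-irrefl (trans (topRun-staircase k k) (sym (smallest-staircase k (2 + j)))) r<s)

count-fixed⁺ : ∀ m → PentagonalPlus m → fixedCount m 0 ≡ 1
count-fixed⁺ m (k , 3≤k , e) = hasCount-singleton (hasCount-fixed m 0) (staircase⁺-fixed 3≤k e) unique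
  where
  unique : ∀ {μ} → FranklinFixed m 0 μ → μ ≡ staircase (suc k) k
  unique f with fixed⁺-staircase f
  ... | k′ , (_ , e′) , μ≡
    with range-index-≡ (≤-trans (s≤s z≤n) 3≤k) (plus-range {k} e) (plus-range {k′} e′) ≤-refl (m≤n+m _ 4)
  ...   | refl = μ≡

count-fixed⁻ : ∀ m → PentagonalMinus m → fixedCount m 1 ≡ 1
count-fixed⁻ m (k , 3≤k , e) = hasCount-singleton (hasCount-fixed m 1) (staircase⁻-fixed 3≤k e) unique
  where
  unique : ∀ {μ} → FranklinFixed m 1 μ → μ ≡ staircase k k
  unique f with fixed⁻-staircase f
  ... | k′ , (_ , e′) , μ≡
    with range-index-≡ (≤-trans (s≤s z≤n) 3≤k) (minus-range {k} e) (minus-range {k′} e′) ≤-refl (m≤n+m _ 4)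
  ...   | refl = μ≡

count-fixed⁺-none : ∀ m → ¬ PentagonalPlus m → fixedCount m 0 ≡ 0
count-fixed⁺-none m ¬plus =
  hasCount-empty (hasCount-fixed m 0) λ f → let (k , plus , _) = fixed⁺-staircase f in ¬plus (k , plus)

count-fixed⁻-none : ∀ m → ¬ PentagonalMinus m → fixedCount m 1 ≡ 0
count-fixed⁻-none m ¬minus =
  hasCount-empty (hasCount-fixed m 1) λ f → let (k , minus , _) = fixed⁻-staircase f in ¬minus (k , minus)

franklin-balance : ∀ m →
  countTop3 3 m 0 + fixedCount m 1 ≡ countTop3 3 m 1 + fixedCount m 0
franklin-balance m = begin
  T 0 + F 1                    ≡⟨ cong (_+ F 1) (split 0) ⟩
  S 0 + (G 0 + F 0) + F 1      ≡⟨ cong (λ x → x + (G 0 + F 0) + F 1) (spread≡gather 0 z≤n) ⟩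
  G 1 + (G 0 + F 0) + F 1      ≡⟨ regroup (G 1) (G 0) (F 0) (F 1) ⟩
  G 0 + (G 1 + F 1) + F 0      ≡⟨ cong (λ x → x + (G 1 + F 1) + F 0) (sym (spread≡gather 1 ≤-refl)) ⟩
  S 1 + (G 1 + F 1) + F 0      ≡⟨ cong (_+ F 0) (sym (split 1)) ⟩
  T 1 + F 0                    ∎
  where
  open ≡-Reasoning
  T S G F : ℕ → ℕ
  T p = countTop3 3 m p
  S p = count (top3DistinctParity? 3 m p ∩? spreadApplies?) m
  G p = count ((top3DistinctParity? 3 m p ∩? ∁? spreadApplies?) ∩? gatherApplies?) m
  F p = fixedCount m p
  split : ∀ p → T p ≡ S p + (G p + F p)
  split p = trans (count-split (top3DistinctParity? 3 m p) spreadApplies? m)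
                  (cong (S p +_) (count-split (top3DistinctParity? 3 m p ∩? ∁? spreadApplies?) gatherApplies? m))
  spread≡gather : ∀ p → p ≤ 1 → S p ≡ G (1 ∸ p)
  spread≡gather p p≤1 = hasCount-unique
    (franklin-bijection m p p≤1 (hasCount-top3Distinct _ 3 m (s≤s z≤n) (λ x → proj₁ (proj₁ x))))
    (hasCount-top3Distinct _ 3 m (s≤s z≤n) (λ x → proj₁ (proj₁ (proj₁ x)))) id id
  regroup : ∀ g₁ g₀ f₀ f₁ → g₁ + (g₀ + f₀) + f₁ ≡ g₀ + (g₁ + f₁) + f₀
  regroup = solve-∀

-- Removing a smallest part 2

SmallestTwo ThreeParts : List ℕ → Set
SmallestTwo μ = smallest μ ≡ 2
ThreeParts μ = length μ ≡ 3

smallestTwo? : Decidable SmallestTwo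
smallestTwo? μ = smallest μ ≟ 2

threeParts? : Decidable ThreeParts
threeParts? μ = length μ ≟ 3

count432 : ℕ → ℕ → ℕ
count432 n p = count ((top3DistinctParity? 2 n p ∩? smallestTwo?) ∩? threeParts?) n

count-smallest≥3 : ∀ n p → count (top3DistinctParity? 2 n p ∩? ∁? smallestTwo?) n ≡ countTop3 3 n p
count-smallest≥3 n p = hasCount-unique
  (hasCount-top3Distinct (top3DistinctParity? 2 n p ∩? ∁? smallestTwo?) 2 n (s≤s z≤n) (proj₁ ∘ proj₁))
  (hasCount-top3Distinct (top3DistinctParity? 3 n p) 3 n (s≤s z≤n) proj₁)
  (λ (((d , t , 2≤s , μ-sum) , parity) , s≢2) → (d , t , ≤∧≢⇒< 2≤s (≢-sym s≢2) , μ-sum) , parity)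
  (λ ((d , t , 3≤s , μ-sum) , parity) →
     ((d , t , ≤-trans (n≤1+n 2) 3≤s , μ-sum) , parity) , λ s≡2 → 1+n≰n (subst (3 ≤_) s≡2 3≤s))

smallestTwo-threeParts⇒432 : ∀ {n p μ} → ((Top3DistinctParity 2 n p ∩ SmallestTwo) ∩ ThreeParts) μ →
  μ ≡ 4 ∷ 3 ∷ 2 ∷ [] × n ≡ 9 × p ≡ 0
smallestTwo-threeParts⇒432 ((((_ , (a , [] , refl) , _ , μ-sum) , parity) , refl) , _) = refl , sym μ-sum , sym parity

432-smallestTwo-threeParts : ((Top3DistinctParity 2 9 0 ∩ SmallestTwo) ∩ ThreeParts) (4 ∷ 3 ∷ 2 ∷ [])
432-smallestTwo-threeParts = (((≤-refl ∷ ≤-refl ∷ [-] , (2 , [] , refl) , ≤-refl , refl) , refl) , refl) , refl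

hasCount-432 : ∀ n p → HasCount ((Top3DistinctParity 2 n p ∩ SmallestTwo) ∩ ThreeParts) (count432 n p)
hasCount-432 n p = hasCount-top3Distinct ((top3DistinctParity? 2 n p ∩? smallestTwo?) ∩? threeParts?) 2 n (s≤s z≤n)
  (proj₁ ∘ proj₁ ∘ proj₁)

count432-nine : ∀ n → n ≡ 9 → count432 n 0 ≡ 1
count432-nine .9 refl = hasCount-singleton (hasCount-432 9 0) 432-smallestTwo-threeParts (proj₁ ∘ smallestTwo-threeParts⇒432)

count432-other : ∀ n p → ¬ (n ≡ 9 × p ≡ 0) → count432 n p ≡ 0
count432-other n p ¬n≡9∧p≡0 = hasCount-empty (hasCount-432 n p) (¬n≡9∧p≡0 ∘ proj₂ ∘ smallestTwo-threeParts⇒432)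

count-remove2 : ∀ m p →
  count ((top3DistinctParity? 2 (2 + m) p ∩? smallestTwo?) ∩? ∁? threeParts?) (2 + m) ≡ countTop3 3 m p
count-remove2 m p = hasCount-unique
  (hasCount-top3Distinct ((top3DistinctParity? 2 (2 + m) p ∩? smallestTwo?) ∩? ∁? threeParts?) 2 (2 + m) (s≤s z≤n)
    (proj₁ ∘ proj₁ ∘ proj₁))
  (hasCount-bijection (hasCount-top3Distinct (top3DistinctParity? 3 m p) 3 m (s≤s z≤n) proj₁) (_∷ʳ 2) dropLast
     append2 remove2 (λ {ν} _ → dropLast-∷ʳ ν 2) (λ {μ} ((_ , s≡2) , _) → append2-dropLast μ s≡2))
  id id
  where
  append2-dropLast : ∀ μ → smallest μ ≡ 2 → dropLast μ ∷ʳ 2 ≡ μ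
  append2-dropLast (x ∷ xs) s≡2 = trans (cong (dropLast (x ∷ xs) ∷ʳ_) (sym s≡2)) (dropLast-∷ʳ-smallest x xs)
  append2 : ∀ {ν} → Top3DistinctParity 3 m p ν →
    ((Top3DistinctParity 2 (2 + m) p ∩ SmallestTwo) ∩ ∁ ThreeParts) (ν ∷ʳ 2)
  append2 {ν} ((d , (a , r , refl) , 3≤s , ν-sum) , parity) =
    (((decreasing-∷ʳ ν 2 d (s≤s z≤n) 3≤s , (a , r ∷ʳ 2 , refl) , ≤-reflexive (sym (smallest-∷ʳ ν 2)) ,
      trans (sum-++ ν (2 ∷ [])) (trans (cong (_+ 2) ν-sum) (+-comm m 2))) , parity) ,
     smallest-∷ʳ ν 2) ,
    λ len≡3 → m+1+n≢0 (length r) (trans (sym (length-++ r)) (suc-injective (suc-injective (suc-injective len≡3))))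
  remove2 : ∀ {μ} → ((Top3DistinctParity 2 (2 + m) p ∩ SmallestTwo) ∩ ∁ ThreeParts) μ →
    Top3DistinctParity 3 m p (dropLast μ)
  remove2 ((((_ , (a , [] , refl) , _) , _) , _) , len≢3) = ⊥-elim (len≢3 refl)
  remove2 {μ} ((((d , (a , c ∷ cs , refl) , _ , μ-sum) , parity) , s≡2) , _) =
    (decreasing-dropLast μ d , (a , dropLast (c ∷ cs) , refl) ,
     subst (λ s → suc s ≤ smallest (dropLast μ)) s≡2 (smallest<smallest-dropLast _ _ _ d) ,
     +-cancelʳ-≡ 2 _ _ (begin
       sum (dropLast μ) + 2           ≡⟨ cong (sum (dropLast μ) +_) (sym s≡2) ⟩
       sum (dropLast μ) + smallest μ  ≡⟨ sum-dropLast (suc (suc a)) (suc a ∷ a ∷ c ∷ cs) ⟩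
       sum μ                          ≡⟨ μ-sum ⟩
       2 + m                          ≡⟨ +-comm 2 m ⟩
       m + 2                          ∎)) ,
    parity
    where open ≡-Reasoning

countTop3-split : ∀ m p → countTop3 2 (2 + m) p ≡ count432 (2 + m) p + countTop3 3 m p + countTop3 3 (2 + m) p
countTop3-split m p = begin
  countTop3 2 n p
    ≡⟨ count-split (top3DistinctParity? 2 n p) smallestTwo? n ⟩
  count (top3DistinctParity? 2 n p ∩? smallestTwo?) n + count (top3DistinctParity? 2 n p ∩? ∁? smallestTwo?) n
    ≡⟨ cong₂ _+_ (count-split (top3DistinctParity? 2 n p ∩? smallestTwo?) threeParts? n) (count-smallest≥3 n p) ⟩
  count432 n p + count ((top3DistinctParity? 2 n p ∩? smallestTwo?) ∩? ∁? threeParts?) n + countTop3 3 n p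
    ≡⟨ cong (λ c → count432 n p + c + countTop3 3 n p) (count-remove2 m p) ⟩
  count432 n p + countTop3 3 m p + countTop3 3 n p ∎
  where
  open ≡-Reasoning
  n : ℕ
  n = 2 + m

plusExcess minusExcess : ℕ → ℕ
plusExcess m = count432 (2 + m) 0 + fixedCount m 0 + fixedCount (2 + m) 0
minusExcess m = fixedCount m 1 + fixedCount (2 + m) 1

excess-balance : ∀ m → countTop3 2 (2 + m) 0 + minusExcess m ≡ countTop3 2 (2 + m) 1 + plusExcess m
excess-balance m = begin
  countTop3 2 n 0 + (F m 1 + F n 1)
    ≡⟨ cong (_+ (F m 1 + F n 1)) (countTop3-split m 0) ⟩
  count432 n 0 + T m 0 + T n 0 + (F m 1 + F n 1)
    ≡⟨ regroup (count432 n 0) (T m 0) (T n 0) (F m 1) (F n 1) ⟩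
  count432 n 0 + (T m 0 + F m 1) + (T n 0 + F n 1)
    ≡⟨ cong₂ (λ x y → count432 n 0 + x + y) (franklin-balance m) (franklin-balance n) ⟩
  count432 n 0 + (T m 1 + F m 0) + (T n 1 + F n 0)
    ≡⟨ regroup′ (count432 n 0) (T m 1) (T n 1) (F m 0) (F n 0) ⟩
  0 + T m 1 + T n 1 + plusExcess m
    ≡⟨ cong (λ c → c + T m 1 + T n 1 + plusExcess m) (sym (count432-other n 1 λ ())) ⟩
  count432 n 1 + T m 1 + T n 1 + plusExcess m
    ≡⟨ cong (_+ plusExcess m) (sym (countTop3-split m 1)) ⟩
  countTop3 2 n 1 + plusExcess m ∎
  where
  open ≡-Reasoning
  n : ℕ
  n = 2 + m
  T F : ℕ → ℕ → ℕ
  T = countTop3 3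
  F = fixedCount
  regroup : ∀ a t₀ t₀′ f₁ f₁′ → a + t₀ + t₀′ + (f₁ + f₁′) ≡ a + (t₀ + f₁) + (t₀′ + f₁′)
  regroup = solve-∀
  regroup′ : ∀ a t₁ t₁′ f₀ f₀′ → a + (t₁ + f₀) + (t₁′ + f₀′) ≡ 0 + t₁ + t₁′ + (a + f₀ + f₀′)
  regroup′ = solve-∀

-- The exceptional forms

^2≡* : ∀ t → t ^ 2 ≡ t * t
^2≡* t = cong (t *_) (*-identityʳ t)

3[1+t]^2 : ∀ t → 3 * (t + 1) ^ 2 ≡ 3 * (suc t * suc t)
3[1+t]^2 t = cong (3 *_) (trans (^2≡* (t + 1)) (cong (λ k → k * k) (+-comm t 1)))

≡∸⇔+≡ : ∀ {x a b} → b ≤ a → (x ≡ a ∸ b) ⇔ (x + b ≡ a)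
≡∸⇔+≡ {x} {a} {b} b≤a = mk⇔ (λ { refl → m∸n+n≡m b≤a }) (λ { refl → sym (m+n∸n≡m x b) })

formA⇔ : ∀ m → FormA (2 + m) ⇔ (2 + m ≡ 9 ⊎ PentagonalPlus m)
formA⇔ m = mk⇔ formA⇒ ⇒formA
  where
  twice : ∀ m → 2 * (2 + m) ≡ 2 * m + 4
  twice = solve-∀
  square : ∀ t → 3 * t ^ 2 + t + 4 ≡ 3 * (t * t) + t + 4
  square t = cong (λ s → 3 * s + t + 4) (^2≡* t)
  formA⇒ : FormA (2 + m) → 2 + m ≡ 9 ⊎ PentagonalPlus m
  formA⇒ (1 , s≤s () , _)
  formA⇒ (2 , _ , e) = inj₁ (*-cancelˡ-≡ (2 + m) 9 2 e)
  formA⇒ (t@(suc (suc (suc _))) , _ , e) =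
    inj₂ (t , s≤s (s≤s (s≤s z≤n)) , +-cancelʳ-≡ 4 _ _ (trans (sym (twice m)) (trans e (square t))))
  ⇒formA : 2 + m ≡ 9 ⊎ PentagonalPlus m → FormA (2 + m)
  ⇒formA (inj₁ n≡9) = 2 , ≤-refl , cong (2 *_) n≡9
  ⇒formA (inj₂ (k , 3≤k , e)) = k , ≤-trans (n≤1+n 2) 3≤k , trans (twice m) (trans (cong (_+ 4) e) (sym (square k)))

formD⇔ : ∀ n → FormD n ⇔ PentagonalPlus n
formD⇔ n = mk⇔ (λ (t , 2≤t , e) → suc t , s≤s 2≤t , trans e (regroup t))
               (λ { (suc t , s≤s 2≤t , e) → t , 2≤t , trans e (sym (regroup t)) })
  where
  regroup : ∀ t → 3 * (t + 1) ^ 2 + t + 1 ≡ 3 * (suc t * suc t) + suc t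
  regroup t = trans (cong (λ s → s + t + 1) (3[1+t]^2 t))
                    (trans (+-assoc _ t 1) (cong (3 * (suc t * suc t) +_) (+-comm t 1)))

formB⇔ : ∀ n → FormB n ⇔ PentagonalMinus n
formB⇔ n = mk⇔ (λ (t , 2≤t , e) → suc t , s≤s 2≤t , to (≡∸⇔+≡ (k≤3k² t)) (trans e (rearrange t)))
               (λ { (suc t , s≤s 2≤t , e) → t , 2≤t , trans (from (≡∸⇔+≡ (k≤3k² t)) e) (sym (rearrange t)) })
  where
  k≤3k² : ∀ t → suc t ≤ 3 * (suc t * suc t)
  k≤3k² t = subst (suc t ≤_) (sym (regroup t)) (m≤m+n (suc t) _)
    where
    regroup : ∀ t → 3 * (suc t * suc t) ≡ suc t + (3 * (t * t) + 5 * t + 2)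
    regroup = solve-∀
  rearrange : ∀ t → 3 * (t + 1) ^ 2 ∸ t ∸ 1 ≡ 3 * (suc t * suc t) ∸ suc t
  rearrange t = trans (∸-+-assoc (3 * (t + 1) ^ 2) t 1) (cong₂ _∸_ (3[1+t]^2 t) (+-comm t 1))

formC⇔ : ∀ m → FormC (2 + m) ⇔ PentagonalMinus m
formC⇔ m = mk⇔
  (λ (t , 2≤t , e) → suc t , s≤s 2≤t ,
     +-cancelʳ-≡ 3 _ _ (trans (regroup m t) (to (≡∸⇔+≡ (t≤3[1+t]²+3 t)) (trans e (rearrange t)))))
  (λ { (suc t , s≤s 2≤t , e) → t , 2≤t ,
     trans (from (≡∸⇔+≡ (t≤3[1+t]²+3 t)) (trans (sym (regroup m t)) (cong (_+ 3) e))) (sym (rearrange t)) })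
  where
  t≤3[1+t]²+3 : ∀ t → t ≤ 3 * (suc t * suc t) + 3
  t≤3[1+t]²+3 t = subst (t ≤_) (sym (expand t)) (m≤m+n t _)
    where
    expand : ∀ t → 3 * (suc t * suc t) + 3 ≡ t + (3 * (t * t) + 5 * t + 6)
    expand = solve-∀
  rearrange : ∀ t → 3 * (t + 1) ^ 2 + 3 ∸ t ≡ 3 * (suc t * suc t) + 3 ∸ t
  rearrange t = cong (λ s → s + 3 ∸ t) (3[1+t]^2 t)
  regroup : ∀ m t → 2 * m + suc t + 3 ≡ 2 * (2 + m) + t
  regroup = solve-∀

nine-not-pentagonal : ∀ {m} → 2 + m ≡ 9 → ¬ Pentagonal m × ¬ Pentagonal (2 + m)
nine-not-pentagonal refl =
  (λ p → from-no (12 ≤? 7) (pentagonal-≥12 p)) , (λ p → from-no (12 ≤? 9) (pentagonal-≥12 p))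

plusExcess-one : ∀ m → FormA (2 + m) ⊎ FormD (2 + m) → plusExcess m ≡ 1
plusExcess-one m (inj₁ a) with to (formA⇔ m) a
... | inj₁ n≡9 = cong₂ _+_ (cong₂ _+_ (count432-nine (2 + m) n≡9)
                   (count-fixed⁺-none m λ p → proj₁ (nine-not-pentagonal n≡9) (inj₁ p)))
                   (count-fixed⁺-none (2 + m) λ p → proj₂ (nine-not-pentagonal n≡9) (inj₁ p))
... | inj₂ plus = cong₂ _+_ (cong₂ _+_
                   (count432-other (2 + m) 0 λ (n≡9 , _) → proj₁ (nine-not-pentagonal n≡9) (inj₁ plus))
                   (count-fixed⁺ m plus))
                   (count-fixed⁺-none (2 + m) λ plus′ → pentagonal-gap {m} (inj₁ plus) (inj₁ plus′))
plusExcess-one m (inj₂ d) with to (formD⇔ (2 + m)) d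
... | plus = cong₂ _+_ (cong₂ _+_
               (count432-other (2 + m) 0 λ (n≡9 , _) → proj₂ (nine-not-pentagonal n≡9) (inj₁ plus))
               (count-fixed⁺-none m λ plus′ → pentagonal-gap {m} (inj₁ plus′) (inj₁ plus)))
               (count-fixed⁺ (2 + m) plus)

plusExcess-zero : ∀ m → ¬ FormA (2 + m) → ¬ FormD (2 + m) → plusExcess m ≡ 0
plusExcess-zero m ¬a ¬d =
  cong₂ _+_ (cong₂ _+_ (count432-other (2 + m) 0 λ (n≡9 , _) → ¬a (from (formA⇔ m) (inj₁ n≡9)))
                       (count-fixed⁺-none m λ p → ¬a (from (formA⇔ m) (inj₂ p))))
            (count-fixed⁺-none (2 + m) λ p → ¬d (from (formD⇔ (2 + m)) p))

minusExcess-one : ∀ m → FormB (2 + m) ⊎ FormC (2 + m) → minusExcess m ≡ 1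
minusExcess-one m (inj₁ b) with to (formB⇔ (2 + m)) b
... | minus = cong₂ _+_ (count-fixed⁻-none m λ minus′ → pentagonal-gap {m} (inj₂ minus′) (inj₂ minus))
                        (count-fixed⁻ (2 + m) minus)
minusExcess-one m (inj₂ c) with to (formC⇔ m) c
... | minus = cong₂ _+_ (count-fixed⁻ m minus)
                        (count-fixed⁻-none (2 + m) λ minus′ → pentagonal-gap {m} (inj₂ minus) (inj₂ minus′))

minusExcess-zero : ∀ m → ¬ FormB (2 + m) → ¬ FormC (2 + m) → minusExcess m ≡ 0
minusExcess-zero m ¬b ¬c = cong₂ _+_ (count-fixed⁻-none m λ p → ¬c (from (formC⇔ m) p))
                                     (count-fixed⁻-none (2 + m) λ p → ¬b (from (formB⇔ (2 + m)) p))

forms-exclusive : ∀ m → FormA (2 + m) ⊎ FormD (2 + m) → FormB (2 + m) ⊎ FormC (2 + m) → ⊥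
forms-exclusive m ad bc =
  exclusive (Sum.map (to (formA⇔ m)) (to (formD⇔ (2 + m))) ad) (Sum.map (to (formB⇔ (2 + m))) (to (formC⇔ m)) bc)
  where
  exclusive : (2 + m ≡ 9 ⊎ PentagonalPlus m) ⊎ PentagonalPlus (2 + m) →
    PentagonalMinus (2 + m) ⊎ PentagonalMinus m → ⊥
  exclusive (inj₁ (inj₁ n≡9)) (inj₁ minus) = proj₂ (nine-not-pentagonal n≡9) (inj₂ minus)
  exclusive (inj₁ (inj₁ n≡9)) (inj₂ minus) = proj₁ (nine-not-pentagonal n≡9) (inj₂ minus)
  exclusive (inj₁ (inj₂ plus)) (inj₁ minus) = pentagonal-gap {m} (inj₁ plus) (inj₂ minus)
  exclusive (inj₁ (inj₂ plus)) (inj₂ minus) = plus-minus-disjoint {m} plus minus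
  exclusive (inj₂ plus) (inj₁ minus) = plus-minus-disjoint {2 + m} plus minus
  exclusive (inj₂ plus) (inj₂ minus) = pentagonal-gap {m} (inj₂ minus) (inj₁ plus)

-- The hypothesis 6 ≤ n is only used to write n = 2 + m.
corollary4p9 : (n : ℕ) → 6 ≤ n →
    Σ ℕ λ e → Σ ℕ λ o →
      HasCount (EvenCounted n) e × HasCount (OddCounted n) o
      × ((¬ FormA n × ¬ FormB n × ¬ FormC n × ¬ FormD n) → e ≡ o)
      × ((FormA n ⊎ FormD n) → e ≡ o + 1)
      × ((FormB n ⊎ FormC n) → e + 1 ≡ o)
corollary4p9 (suc zero) (s≤s ())
corollary4p9 (suc (suc m)) _ =
  countTop3 2 n 0 , countTop3 2 n 1 ,
  hasCount-conjugate n 0 (hasCount-top3Distinct (top3DistinctParity? 2 n 0) 2 n (s≤s z≤n) proj₁) ,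
  hasCount-conjugate n 1 (hasCount-top3Distinct (top3DistinctParity? 2 n 1) 2 n (s≤s z≤n) proj₁) ,
  (λ (¬a , ¬b , ¬c , ¬d) → trans (sym (+-identityʳ _))
     (trans (balance (minusExcess-zero m ¬b ¬c) (plusExcess-zero m ¬a ¬d)) (+-identityʳ _))) ,
  (λ ad → trans (sym (+-identityʳ _))
     (balance (minusExcess-zero m (forms-exclusive m ad ∘ inj₁) (forms-exclusive m ad ∘ inj₂)) (plusExcess-one m ad))) ,
  (λ bc → trans (balance (minusExcess-one m bc)
     (plusExcess-zero m (λ a → forms-exclusive m (inj₁ a) bc) (λ d → forms-exclusive m (inj₂ d) bc))) (+-identityʳ _))
  where
  n : ℕ
  n = 2 + m
  balance : ∀ {x y} → minusExcess m ≡ x → plusExcess m ≡ y → countTop3 2 n 0 + x ≡ countTop3 2 n 1 + y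
  balance refl refl = excess-balance m
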